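{- Let $q=p^n$ be a power of an odd prime $p\neq 3$ with $q\equiv 3\pmod 4$. Then the differential uniformity of $F_{2,\frac13}(x)=x^2\big(1+\frac13\eta(x)\big)$ over $\mathbb{F}_q$ is at most $4$.
   Context: $\eta$ is the quadratic character of $\mathbb{F}_q$ ($\eta(0)=0$, $\eta=1$ on nonzero squares, $-1$ on non-squares). For $f$ on $\mathbb{F}_q$, $\delta_f(a,b)=\#\{x\in\mathbb{F}_q: f(x+a)-f(x)=b\}$ and the differential uniformity is $\delta_f=\max_{a\in\mathbb{F}_q^*,b\in\mathbb{F}_q}\delta_f(a,b)$. -}

module Defs where

open import Level using (Level; _⊔_) renaming (suc to lsuc)
open import Data.Nat as ℕ using (ℕ)
open import Data.List using (List; length; filter)
open import Data.List.Relation.Unary.Any using (Any; any?)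
open import Data.List.Relation.Unary.AllPairs using (AllPairs)
open import Relation.Nullary using (¬_; Dec; yes; no)
open import Relation.Binary.Definitions using (Decidable)
open import Algebra.Bundles using (CommutativeRing)

record FiniteField (c ℓ : Level) : Set (lsuc (c ⊔ ℓ)) where
  field
    commRing : CommutativeRing c ℓ
  open CommutativeRing commRing public
  field
    _≟_      : Decidable _≈_
    1≉0      : ¬ (1# ≈ 0#)
    _⁻¹      : Carrier → Carrier
    ⁻¹-inv   : ∀ x → ¬ (x ≈ 0#) → x * (x ⁻¹) ≈ 1#
    elements : List Carrier
    complete : ∀ x → Any (x ≈_) elements
    distinct : AllPairs (λ x y → ¬ (x ≈ y)) elements

  order : ℕ
  order = length elements

  η : Carrier → Carrier
  η x with x ≟ 0#
  ... | yes _ = 0#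
  ... | no _ with any? (λ y → (y * y) ≟ x) elements
  ...   | yes _ = 1#
  ...   | no _ = - 1#

  three : Carrier
  three = 1# + 1# + 1#

  F₂,⅓ : Carrier → Carrier
  F₂,⅓ x = (x * x) * (1# + (three ⁻¹) * η x)

  δ : (Carrier → Carrier) → Carrier → Carrier → ℕ
  δ f a b = length (filter (λ x → (f (x + a) - f x) ≟ b) elements)

  DiffUniformityAtMost : (Carrier → Carrier) → ℕ → Set (c ⊔ ℓ)
  DiffUniformityAtMost f k = ∀ a b → ¬ (a ≈ 0#) → δ f a b ℕ.≤ k

-- Fix a ≠ 0 and b, and let d = 2/3 and w = d a², so that F₂,⅓ is 2d x² on nonzero
-- squares and d x² on nonsquares.  Sorting the solutions x of F(x + a) - F(x) = b by
-- the quadratic characters of x + a and x, the equation becomes c₁ (x + a)² - c₂ x² = b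
-- with c₁, c₂ ∈ {0, d, 2d}: it determines x when c₁ or c₂ vanishes or c₁ = c₂, and is
-- a genuine quadratic otherwise.  In every class, one or two solutions force relations
-- between the characters of d and of b + k w, k = ±1, ±2; for instance two roots of
-- 2d (x + a)² - d x² = b satisfy x + y = -4a, so -(b - 2w) = d x y has the character
-- of d.  Since η(-1) = -1 (as q ≡ 3 mod 4) and the four values b + k w are distinct,
-- a finite check over all sign patterns bounds the number of solutions by 4.

module Submission where

open import Defs
open import Level using (Level)
open import Data.Nat using (ℕ; _%_; _^_; _≥_)
open import Data.Nat.Primality using (Prime)
open import Relation.Binary.PropositionalEquality using (_≡_; _≢_)
open import Algebra.Bundles using (CommutativeRing)
open import Relation.Binary.Bundles using (Setoid)
open import Relation.Binary.Definitions using (DecidableEquality)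

module IntegerCoefficientSolver {c ℓ} (R : CommutativeRing c ℓ) where
  open import Data.Nat as ℕ using (ℕ; zero; suc)
  import Data.Nat.Properties as ℕ
  open import Data.Integer as ℤ using (ℤ; +_; -[1+_]; _⊖_; _◃_; sign; ∣_∣)
  import Data.Integer.Properties as ℤ
  open import Data.Sign as Sign using (Sign)
  open import Data.Maybe using (Maybe; just; nothing)
  open import Relation.Nullary using (yes; no)
  open import Relation.Binary.PropositionalEquality as ≡ using (_≡_)
  import Algebra.Solver.Ring.AlmostCommutativeRing as ACR

  open CommutativeRing R
  open import Algebra.Properties.Semiring.Mult semiring using (_×_; ×-homo-+; ×1-homo-*)
  open import Algebra.Properties.Ring ring using (-‿involutive; -‿distribˡ-*; -‿distribʳ-*; -0#≈0#)
  open import Algebra.Properties.AbelianGroup +-abelianGroup using (⁻¹-∙-comm)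
  open import Algebra.Properties.CommutativeSemigroup +-commutativeSemigroup using (interchange)
  open import Algebra.Properties.CommutativeSemigroup *-commutativeSemigroup using () renaming (interchange to interchange-*)
  open import Relation.Binary.Reasoning.Setoid setoid

  ι : ℤ → Carrier
  ι (+ n) = n × 1#
  ι -[1+ n ] = - (suc n × 1#)

  ι-‿ : ∀ i → ι (ℤ.- i) ≈ - ι i
  ι-‿ (+ zero) = sym -0#≈0#
  ι-‿ (+ suc n) = refl
  ι-‿ -[1+ n ] = sym (-‿involutive _)

  ι-⊖ : ∀ m n → ι (m ⊖ n) ≈ m × 1# - n × 1#
  ι-⊖ zero zero = sym (-‿inverseʳ 0#)
  ι-⊖ zero (suc n) = sym (+-identityˡ _)
  ι-⊖ (suc m) zero = sym (trans (+-congˡ -0#≈0#) (+-identityʳ _))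
  ι-⊖ (suc m) (suc n) = begin
    ι (suc m ⊖ suc n)             ≡⟨ ≡.cong ι (ℤ.[1+m]⊖[1+n]≡m⊖n m n) ⟩
    ι (m ⊖ n)                     ≈⟨ ι-⊖ m n ⟩
    m × 1# - n × 1#                  ≈⟨ +-identityˡ _ ⟨
    0# + (m × 1# - n × 1#)           ≈⟨ +-congʳ (-‿inverseʳ 1#) ⟨
    (1# - 1#) + (m × 1# - n × 1#)    ≈⟨ interchange 1# (- 1#) (m × 1#) (- (n × 1#)) ⟩
    (1# + m × 1#) + (- 1# - n × 1#)  ≈⟨ +-congˡ (⁻¹-∙-comm 1# (n × 1#)) ⟩
    (1# + m × 1#) - (1# + n × 1#)    ∎

  ι-+ : ∀ i j → ι (i ℤ.+ j) ≈ ι i + ι j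
  ι-+ (+ m) (+ n) = ×-homo-+ 1# m n
  ι-+ (+ m) -[1+ n ] = ι-⊖ m (suc n)
  ι-+ -[1+ m ] (+ n) = trans (ι-⊖ n (suc m)) (+-comm _ _)
  ι-+ -[1+ m ] -[1+ n ] = begin
    - (suc (suc (m ℕ.+ n)) × 1#)           ≡⟨ ≡.cong (λ k → - (suc k × 1#)) (ℕ.+-suc m n) ⟨
    - ((suc m ℕ.+ suc n) × 1#)             ≈⟨ -‿cong (×-homo-+ 1# (suc m) (suc n)) ⟩
    - (suc m × 1# + suc n × 1#)            ≈⟨ ⁻¹-∙-comm _ _ ⟨
    - (suc m × 1#) + - (suc n × 1#)        ∎

  ⟦_⟧ˢ : Sign → Carrier
  ⟦ Sign.+ ⟧ˢ = 1#
  ⟦ Sign.- ⟧ˢ = - 1#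

  ι-◃ : ∀ s n → ι (s ◃ n) ≈ ⟦ s ⟧ˢ * (n × 1#)
  ι-◃ s zero = sym (zeroʳ _)
  ι-◃ Sign.+ (suc n) = sym (*-identityˡ _)
  ι-◃ Sign.- (suc n) = trans (-‿cong (sym (*-identityˡ _))) (-‿distribˡ-* _ _)

  ⟦⟧ˢ-* : ∀ s t → ⟦ s Sign.* t ⟧ˢ ≈ ⟦ s ⟧ˢ * ⟦ t ⟧ˢ
  ⟦⟧ˢ-* Sign.+ t = sym (*-identityˡ _)
  ⟦⟧ˢ-* Sign.- Sign.+ = sym (*-identityʳ _)
  ⟦⟧ˢ-* Sign.- Sign.- = begin
    1#              ≈⟨ -‿involutive 1# ⟨
    - - 1#          ≈⟨ -‿cong (*-identityʳ _) ⟨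
    - (- 1# * 1#)   ≈⟨ -‿distribʳ-* _ _ ⟩
    - 1# * - 1#     ∎

  ι-* : ∀ i j → ι (i ℤ.* j) ≈ ι i * ι j
  ι-* i j = begin
    ι (i ℤ.* j)                                         ≈⟨ ι-◃ (sign i Sign.* sign j) (∣ i ∣ ℕ.* ∣ j ∣) ⟩
    ⟦ sign i Sign.* sign j ⟧ˢ * ((∣ i ∣ ℕ.* ∣ j ∣) × 1#) ≈⟨ *-cong (⟦⟧ˢ-* (sign i) (sign j)) (×1-homo-* ∣ i ∣ ∣ j ∣) ⟩
    (⟦ sign i ⟧ˢ * ⟦ sign j ⟧ˢ) * (∣ i ∣ × 1# * ∣ j ∣ × 1#) ≈⟨ interchange-* _ _ _ _ ⟩
    (⟦ sign i ⟧ˢ * ∣ i ∣ × 1#) * (⟦ sign j ⟧ˢ * ∣ j ∣ × 1#) ≈⟨ *-cong (ι-◃ (sign i) ∣ i ∣) (ι-◃ (sign j) ∣ j ∣) ⟨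
    ι (sign i ◃ ∣ i ∣) * ι (sign j ◃ ∣ j ∣)               ≡⟨ ≡.cong₂ (λ u v → ι u * ι v) (ℤ.◃-inverse i) (ℤ.◃-inverse j) ⟩
    ι i * ι j ∎

  morphism : ℤ.+-*-rawRing ACR.-Raw-AlmostCommutative⟶ ACR.fromCommutativeRing R
  morphism = record
    { ⟦_⟧ = ι ; +-homo = ι-+ ; *-homo = ι-* ; -‿homo = ι-‿
    ; 0-homo = refl ; 1-homo = +-identityʳ 1# }

  ι-≟ : ∀ i j → Maybe (ι i ≈ ι j)
  ι-≟ i j with i ℤ.≟ j
  ... | yes i≡j = just (reflexive (≡.cong ι i≡j))
  ... | no _ = nothing

  open import Algebra.Solver.Ring ℤ.+-*-rawRing (ACR.fromCommutativeRing R) morphism ι-≟ public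


module UniqueLists {a ℓ} (S : Setoid a ℓ) where
  open import Data.Nat as ℕ using (ℕ; suc; _≤_; _+_; z≤n; s≤s)
  import Data.Nat.Properties as ℕ
  open import Data.Nat.Divisibility using (_∣_; _∣0; ∣m∣n⇒∣m+n; ∣-refl)
  open import Data.Empty using (⊥-elim)
  open import Data.Product using (_×_; _,_; proj₁; proj₂)
  open import Data.Sum using (inj₁; inj₂)
  open import Data.List using (List; []; _∷_; length; filter; _++_)
  import Data.List.Properties as List
  open import Data.List.Relation.Unary.All as All using (All; []; _∷_)
  import Data.List.Relation.Unary.All.Properties as All
  open import Data.List.Relation.Unary.Any as Any using (here; there; index)
  open import Data.List.Relation.Unary.AllPairs using ([]; _∷_)
  open import Relation.Nullary using (¬_; ¬?; Dec; yes; no)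
  open import Relation.Binary.Definitions using (Decidable)
  open import Relation.Binary.PropositionalEquality as ≡ using (_≡_)

  open Setoid S renaming (Carrier to A)
  open import Data.List.Membership.Setoid S using (_∈_; _∉_; _─_)
  open import Data.List.Membership.Setoid.Properties
    using (∈-resp-≈; ∉-resp-≈; All[≉]⇒∉; ∈-++⁺ˡ; ∈-++⁺ʳ; ∈-++⁻; ∈-filter⁺; ∈-filter⁻)
  open import Data.List.Relation.Unary.Unique.Setoid S using (Unique)
  import Data.List.Relation.Unary.Unique.Setoid.Properties as Unique
  open import Data.List.Relation.Binary.Subset.Setoid S using (_⊆_)

  ∈-─ : ∀ {x y ys} (p : y ∈ ys) → x ∈ ys → x ≉ y → x ∈ ys ─ p
  ∈-─ (here y≈z) (here x≈z) x≉y = ⊥-elim (x≉y (trans x≈z (sym y≈z)))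
  ∈-─ (here _) (there x∈ys) _ = x∈ys
  ∈-─ (there _) (here x≈z) _ = here x≈z
  ∈-─ (there p) (there x∈ys) x≉y = there (∈-─ p x∈ys x≉y)

  length-mono-⊆ : ∀ {xs ys} → Unique xs → xs ⊆ ys → length xs ≤ length ys
  length-mono-⊆ {[]} _ _ = z≤n
  length-mono-⊆ {x ∷ xs} {ys} (x≉xs ∷ xs!) xs⊆ys = ℕ.≤-trans
    (s≤s (length-mono-⊆ xs! λ z∈xs → ∈-─ x∈ys (xs⊆ys (there z∈xs)) (z≉x z∈xs)))
    (ℕ.≤-reflexive (≡.sym (List.length-removeAt′ ys (index x∈ys))))
    where
    x∈ys = xs⊆ys (here refl)
    z≉x : ∀ {z} → z ∈ xs → z ≉ x
    z≉x z∈xs z≈x = All[≉]⇒∉ S x≉xs (∈-resp-≈ S z≈x z∈xs)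

  length-≡-⊆⊇ : ∀ {xs ys} → Unique xs → Unique ys → xs ⊆ ys → ys ⊆ xs → length xs ≡ length ys
  length-≡-⊆⊇ xs! ys! xs⊆ys ys⊆xs = ℕ.≤-antisym (length-mono-⊆ xs! xs⊆ys) (length-mono-⊆ ys! ys⊆xs)

  module _ {p} {P : A → Set p} {n : ℕ} where

    length≤-of-atMostTwo : ∀ {xs} → Unique xs → All P xs
      → (∀ {x} → P x → 1 ≤ n)
      → (∀ {x y} → P x → P y → x ≉ y → 2 ≤ n)
      → (∀ {x y z} → P x → P y → P z → x ≉ y → x ≉ z → y ≈ z)
      → length xs ≤ n
    length≤-of-atMostTwo [] [] _ _ _ = z≤n
    length≤-of-atMostTwo _ (Px ∷ []) one _ _ = one Px
    length≤-of-atMostTwo ((x≉y ∷ []) ∷ _) (Px ∷ Py ∷ []) _ two _ = two Px Py x≉y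
    length≤-of-atMostTwo ((x≉y ∷ x≉z ∷ _) ∷ (y≉z ∷ _) ∷ _) (Px ∷ Py ∷ Pz ∷ _) _ _ three =
      ⊥-elim (y≉z (three Px Py Pz x≉y x≉z))

    length≤-of-atMostOne : ∀ {xs} → Unique xs → All P xs
      → (∀ {x} → P x → 1 ≤ n)
      → (∀ {x y} → P x → P y → x ≈ y)
      → length xs ≤ n
    length≤-of-atMostOne xs! Pxs one same =
      length≤-of-atMostTwo xs! Pxs one (λ Px Py x≉y → ⊥-elim (x≉y (same Px Py))) (λ Px Py Pz _ _ → trans (sym (same Px Py)) (same Px Pz))

  module WithDecidableEquality (_≟_ : Decidable _≈_) where

    _∉?_ : ∀ x ys → Dec (x ∉ ys)
    x ∉? ys = ¬? (Any.any? (x ≟_) ys)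

    _∖_ : List A → List A → List A
    xs ∖ ys = filter (_∉? ys) xs

    ∈-∖ : ∀ {x xs ys} → x ∈ xs → x ∉ ys → x ∈ xs ∖ ys
    ∈-∖ {ys = ys} = ∈-filter⁺ S (_∉? ys) (∉-resp-≈ S)

    length-∖ : ∀ {xs ys} → Unique xs → Unique ys → ys ⊆ xs → length (xs ∖ ys) + length ys ≡ length xs
    length-∖ {xs} {ys} xs! ys! ys⊆xs = ≡.trans (≡.sym (List.length-++ (xs ∖ ys)))
      (length-≡-⊆⊇ (Unique.++⁺ S (Unique.filter⁺ S (_∉? ys) {xs} xs!) ys! disjoint) xs! ⊆xs xs⊆)
      where
      disjoint : ∀ {v} → ¬ (v ∈ xs ∖ ys × v ∈ ys)
      disjoint (v∈xs∖ys , v∈ys) = proj₂ (∈-filter⁻ S (_∉? ys) (∉-resp-≈ S) {xs = xs} v∈xs∖ys) v∈ys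
      ⊆xs : (xs ∖ ys) ++ ys ⊆ xs
      ⊆xs v∈ with ∈-++⁻ S (xs ∖ ys) v∈
      ... | inj₁ v∈xs∖ys = proj₁ (∈-filter⁻ S (_∉? ys) (∉-resp-≈ S) {xs = xs} v∈xs∖ys)
      ... | inj₂ v∈ys = ys⊆xs v∈ys
      xs⊆ : xs ⊆ (xs ∖ ys) ++ ys
      xs⊆ {v} v∈xs with Any.any? (v ≟_) ys
      ... | yes v∈ys = ∈-++⁺ʳ S (xs ∖ ys) v∈ys
      ... | no v∉ys = ∈-++⁺ˡ S (∈-∖ v∈xs v∉ys)

    module Orbits {g} {G : A → Set g} (orbit : A → List A) (k : ℕ)
      (orbit-unique : ∀ {x} → G x → Unique (orbit x))
      (orbit-length : ∀ {x} → G x → length (orbit x) ≡ k)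
      (orbit-self : ∀ {x} → G x → x ∈ orbit x)
      (orbit-join : ∀ {x y w} → G x → G y → w ∈ orbit y → w ∈ orbit x → y ∈ orbit x)
      where

      Closed : List A → Set _
      Closed xs = All (λ y → orbit y ⊆ xs) xs

      k∣length : ∀ {xs} → Unique xs → All G xs → Closed xs → k ∣ length xs
      k∣length {xs} = go (length xs) ℕ.≤-refl
        where
        go : ∀ n {xs} → length xs ≤ n → Unique xs → All G xs → Closed xs → k ∣ length xs
        go _ {[]} _ _ _ _ = k ∣0
        go (suc n) {xs@(x ∷ _)} len≤ xs! Gxs@(Gx ∷ _) closed@(ox⊆xs ∷ _) =
          ≡.subst (k ∣_) split (∣m∣n⇒∣m+n (go n rest≤n rest! Grest rest-closed) ∣-refl)
          where
          rest = xs ∖ orbit x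
          split : length rest + k ≡ length xs
          split = ≡.subst (λ m → length rest + m ≡ length xs) (orbit-length Gx)
                    (length-∖ xs! (orbit-unique Gx) ox⊆xs)
          rest≤n : length rest ≤ n
          rest≤n = ℕ.≤-pred (begin
            suc (length rest)  ≡⟨ ℕ.+-comm 1 (length rest) ⟩
            length rest + 1    ≤⟨ ℕ.+-monoʳ-≤ (length rest) 1≤k ⟩
            length rest + k    ≡⟨ split ⟩
            length xs          ≤⟨ len≤ ⟩
            suc n              ∎)
            where
            open ℕ.≤-Reasoning
            1≤k : 1 ≤ k
            1≤k with orbit x | orbit-length Gx | orbit-self Gx
            ... | _ ∷ _ | ≡.refl | _ = s≤s z≤n
          rest! : Unique rest
          rest! = Unique.filter⁺ S (_∉? orbit x) {xs} xs!
          Grest : All G rest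
          Grest = All.filter⁺ (_∉? orbit x) Gxs
          rest-closed : Closed rest
          rest-closed = All.map (λ {y} (Gy , oy⊆xs , y∉ox) {w} w∈oy → ∈-∖ (oy⊆xs w∈oy) λ w∈ox → y∉ox (orbit-join Gx Gy w∈oy w∈ox))
            (All.zip (Grest , All.zip (All.filter⁺ (_∉? orbit x) closed , All.all-filter (_∉? orbit x) xs)))

module FilterCounting {a k} {A : Set a} {K : Set k} (_≟_ : DecidableEquality K) (κ : A → K) where
  open import Data.Nat using (ℕ; suc; _≤_; _+_; z≤n; s≤s)
  import Data.Nat.Properties as ℕ
  open import Data.Nat.ListAction using (sum)
  open import Data.List using (List; []; _∷_; length; filter; map)
  import Data.List.Properties as List
  open import Data.List.Membership.Propositional using (_∈_)
  open import Data.List.Relation.Unary.Any using (here; there)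
  open import Relation.Nullary using (yes; no)
  open import Relation.Binary.PropositionalEquality using (_≡_; cong)

  open ℕ.≤-Reasoning

  count : K → List A → ℕ
  count k xs = length (filter (λ x → κ x ≟ k) xs)

  count-∷ : ∀ k x xs → count k xs ≤ count k (x ∷ xs)
  count-∷ k x xs with κ x ≟ k
  ... | yes _ = ℕ.n≤1+n _
  ... | no _ = ℕ.≤-refl

  count-∷-hit : ∀ {k} x xs → κ x ≡ k → count k (x ∷ xs) ≡ suc (count k xs)
  count-∷-hit {k} x xs κx≡k = cong length (List.filter-accept (λ x → κ x ≟ k) κx≡k)

  Σcount : List K → List A → ℕ
  Σcount ks xs = sum (map (λ k → count k xs) ks)

  Σcount-∷ : ∀ {ks} x xs → κ x ∈ ks → suc (Σcount ks xs) ≤ Σcount ks (x ∷ xs)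
  Σcount-∷ {k ∷ ks} x xs (here κx≡k) = begin
    suc (count k xs) + Σcount ks xs     ≡⟨ cong (_+ Σcount ks xs) (count-∷-hit x xs κx≡k) ⟨
    count k (x ∷ xs) + Σcount ks xs     ≤⟨ ℕ.+-monoʳ-≤ (count k (x ∷ xs)) (Σcount-mono ks) ⟩
    Σcount (k ∷ ks) (x ∷ xs)            ∎
    where
    Σcount-mono : ∀ ks → Σcount ks xs ≤ Σcount ks (x ∷ xs)
    Σcount-mono [] = z≤n
    Σcount-mono (k ∷ ks) = ℕ.+-mono-≤ (count-∷ k x xs) (Σcount-mono ks)
  Σcount-∷ {k ∷ ks} x xs (there κx∈ks) = begin
    suc (count k xs + Σcount ks xs)     ≡⟨ ℕ.+-suc (count k xs) _ ⟨
    count k xs + suc (Σcount ks xs)     ≤⟨ ℕ.+-mono-≤ (count-∷ k x xs) (Σcount-∷ x xs κx∈ks) ⟩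
    Σcount (k ∷ ks) (x ∷ xs)            ∎

  Σcount≤ : ∀ {xs} (f : K → ℕ) → (∀ k → count k xs ≤ f k) → ∀ ks → Σcount ks xs ≤ sum (map f ks)
  Σcount≤ f count≤f [] = z≤n
  Σcount≤ {xs} f count≤f (k ∷ ks) = ℕ.+-mono-≤ (count≤f k) (Σcount≤ {xs} f count≤f ks)

  length≤Σcount : ∀ ks → (∀ x → κ x ∈ ks) → ∀ xs → length xs ≤ Σcount ks xs
  length≤Σcount ks κ∈ks [] = z≤n
  length≤Σcount ks κ∈ks (x ∷ xs) = ℕ.≤-trans (s≤s (length≤Σcount ks κ∈ks xs)) (Σcount-∷ x xs (κ∈ks x))

module Signs where
  open import Data.List using (List; []; _∷_)
  open import Data.List.Membership.Propositional using (_∈_)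
  open import Data.List.Relation.Unary.Any using (here; there)
  open import Relation.Nullary using (Dec; yes; no)
  open import Relation.Unary using (Pred; Decidable)
  open import Relation.Binary.PropositionalEquality using (_≡_; refl)
  open import Relation.Binary.Definitions using (DecidableEquality)

  data Sign : Set where
    0ˢ 1ˢ -1ˢ : Sign

  infix 4 _≟ˢ_
  _≟ˢ_ : DecidableEquality Sign
  0ˢ ≟ˢ 0ˢ = yes refl
  0ˢ ≟ˢ 1ˢ = no λ ()
  0ˢ ≟ˢ -1ˢ = no λ ()
  1ˢ ≟ˢ 0ˢ = no λ ()
  1ˢ ≟ˢ 1ˢ = yes refl
  1ˢ ≟ˢ -1ˢ = no λ ()
  -1ˢ ≟ˢ 0ˢ = no λ ()
  -1ˢ ≟ˢ 1ˢ = no λ ()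
  -1ˢ ≟ˢ -1ˢ = yes refl

  infixl 7 _·ˢ_
  _·ˢ_ : Sign → Sign → Sign
  0ˢ ·ˢ _ = 0ˢ
  1ˢ ·ˢ t = t
  -1ˢ ·ˢ 0ˢ = 0ˢ
  -1ˢ ·ˢ 1ˢ = -1ˢ
  -1ˢ ·ˢ -1ˢ = 1ˢ

  infix 8 -ˢ_
  -ˢ_ : Sign → Sign
  -ˢ s = -1ˢ ·ˢ s

  allSigns : List Sign
  allSigns = 0ˢ ∷ 1ˢ ∷ -1ˢ ∷ []

  ∈-allSigns : ∀ s → s ∈ allSigns
  ∈-allSigns 0ˢ = here refl
  ∈-allSigns 1ˢ = there (here refl)
  ∈-allSigns -1ˢ = there (there (here refl))

  ·ˢ-identityʳ : ∀ s → s ·ˢ 1ˢ ≡ s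
  ·ˢ-identityʳ 0ˢ = refl
  ·ˢ-identityʳ 1ˢ = refl
  ·ˢ-identityʳ -1ˢ = refl

  ∀ˢ? : ∀ {p} {P : Pred Sign p} → Decidable P → Dec (∀ s → P s)
  ∀ˢ? P? with P? 0ˢ | P? 1ˢ | P? -1ˢ
  ... | yes p₀ | yes p₁ | yes p₋₁ = yes λ { 0ˢ → p₀ ; 1ˢ → p₁ ; -1ˢ → p₋₁ }
  ... | no ¬p₀ | _ | _ = no λ ∀P → ¬p₀ (∀P 0ˢ)
  ... | yes _ | no ¬p₁ | _ = no λ ∀P → ¬p₁ (∀P 1ˢ)
  ... | yes _ | yes _ | no ¬p₋₁ = no λ ∀P → ¬p₋₁ (∀P -1ˢ)

module SignPatterns where
  open Signs
  open import Data.Bool using (Bool; if_then_else_; _∧_; not)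
  open import Data.Nat using (ℕ; _≤_; _≤?_)
  open import Data.Product using (_×_; _,_)
  open import Data.List using (List; []; _∷_; map; cartesianProduct)
  open import Data.Nat.ListAction using (sum)
  open import Data.List.Relation.Unary.AllPairs using (AllPairs; allPairs?)
  open import Data.List.Membership.Propositional using (_∈_)
  open import Data.List.Membership.Propositional.Properties using (∈-cartesianProduct⁺)
  open import Relation.Nullary using (¬?; does)
  open import Relation.Nullary.Decidable using (_→-dec_; toWitness)
  open import Relation.Binary.PropositionalEquality using (_≡_; _≢_)

  infix 4 _==_
  _==_ : Sign → Sign → Bool
  s == t = does (s ≟ˢ t)

  [_] : Bool → ℕ
  [ b ] = if b then 1 else 0

  quadraticBound : Sign → Sign → Sign → Sign → ℕ
  quadraticBound δ u v v′ =
    if δ ·ˢ u == -1ˢ then 0 else if u == 0ˢ then 1 else if (v == δ) ∧ (v′ == δ) then 2 else 1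

  -- In the application δ is the character of d = 2/3 and εₖ that of b + k d a².
  record Pattern : Set where
    constructor signs
    field δ ε₋₂ ε₋₁ ε₁ ε₂ : Sign

  bound : Sign × Sign → Pattern → ℕ
  bound (0ˢ , 0ˢ) π = 0
  bound (1ˢ , 0ˢ) π = [ Pattern.ε₋₂ π == 0ˢ ]
  bound (-1ˢ , 0ˢ) π = [ Pattern.ε₋₁ π == 0ˢ ]
  bound (0ˢ , 1ˢ) π = [ Pattern.ε₂ π == 0ˢ ]
  bound (0ˢ , -1ˢ) π = [ Pattern.ε₁ π == 0ˢ ]
  bound (1ˢ , 1ˢ) (signs _ ε₋₂ _ _ ε₂) = [ (ε₂ == ε₋₂) ∧ not (ε₂ == 0ˢ) ]
  bound (-1ˢ , -1ˢ) (signs _ _ ε₋₁ ε₁ _) = [ (ε₁ == ε₋₁) ∧ not (ε₁ == 0ˢ) ]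
  bound (1ˢ , -1ˢ) (signs δ ε₋₂ _ ε₁ ε₂) = quadraticBound δ ε₂ (-ˢ ε₋₂) (-ˢ ε₁)
  bound (-1ˢ , 1ˢ) (signs δ ε₋₂ ε₋₁ _ ε₂) = quadraticBound δ (-ˢ ε₋₂) ε₋₁ ε₂

  keys : List (Sign × Sign)
  keys = cartesianProduct allSigns allSigns

  ∈-keys : ∀ k → k ∈ keys
  ∈-keys (σ , τ) = ∈-cartesianProduct⁺ (∈-allSigns σ) (∈-allSigns τ)

  total : Pattern → ℕ
  total π = sum (map (λ k → bound k π) keys)

  AtMostOneZero : Pattern → Set
  AtMostOneZero (signs _ ε₋₂ ε₋₁ ε₁ ε₂) = AllPairs (λ s t → s ≡ 0ˢ → t ≢ 0ˢ) (ε₋₂ ∷ ε₋₁ ∷ ε₁ ∷ ε₂ ∷ [])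

  [≡]-positive : ∀ s t → s ≡ t → 1 ≤ [ s == t ]
  [≡]-positive = toWitness {a? = ∀ˢ? λ s → ∀ˢ? λ t → (s ≟ˢ t) →-dec 1 ≤? [ s == t ]} _

  [≡≢0]-positive : ∀ s t → s ≡ t → s ≢ 0ˢ → 1 ≤ [ (s == t) ∧ not (s == 0ˢ) ]
  [≡≢0]-positive = toWitness {a? = ∀ˢ? λ s → ∀ˢ? λ t →
    (s ≟ˢ t) →-dec ¬? (s ≟ˢ 0ˢ) →-dec 1 ≤? [ (s == t) ∧ not (s == 0ˢ) ]} _

  quadraticBound-one : ∀ δ u v v′ → δ ·ˢ u ≢ -1ˢ → 1 ≤ quadraticBound δ u v v′
  quadraticBound-one = toWitness {a? = ∀ˢ? λ δ → ∀ˢ? λ u → ∀ˢ? λ v → ∀ˢ? λ v′ →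
    ¬? (δ ·ˢ u ≟ˢ -1ˢ) →-dec 1 ≤? quadraticBound δ u v v′} _

  quadraticBound-two : ∀ δ u v v′ → δ ·ˢ u ≢ -1ˢ → u ≢ 0ˢ → v ≡ δ → v′ ≡ δ → 2 ≤ quadraticBound δ u v v′
  quadraticBound-two = toWitness {a? = ∀ˢ? λ δ → ∀ˢ? λ u → ∀ˢ? λ v → ∀ˢ? λ v′ →
    ¬? (δ ·ˢ u ≟ˢ -1ˢ) →-dec ¬? (u ≟ˢ 0ˢ) →-dec (v ≟ˢ δ) →-dec (v′ ≟ˢ δ) →-dec 2 ≤? quadraticBound δ u v v′} _

  total≤4 : ∀ π → Pattern.δ π ≢ 0ˢ → AtMostOneZero π → total π ≤ 4
  total≤4 (signs δ ε₋₂ ε₋₁ ε₁ ε₂) = toWitness {a? = ∀ˢ? λ δ → ∀ˢ? λ ε₋₂ → ∀ˢ? λ ε₋₁ → ∀ˢ? λ ε₁ → ∀ˢ? λ ε₂ →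
    ¬? (δ ≟ˢ 0ˢ) →-dec allPairs? (λ s t → (s ≟ˢ 0ˢ) →-dec ¬? (t ≟ˢ 0ˢ)) (ε₋₂ ∷ ε₋₁ ∷ ε₁ ∷ ε₂ ∷ [])
    →-dec total (signs δ ε₋₂ ε₋₁ ε₁ ε₂) ≤? 4} _ δ ε₋₂ ε₋₁ ε₁ ε₂

module FieldProperties {c ℓ} (𝔽 : FiniteField c ℓ) where
  import Data.Integer as ℤ
  open import Data.Nat.Divisibility using (_∣_)
  open import Data.Empty using (⊥-elim)
  open import Data.Unit.Polymorphic using (⊤)
  open import Data.Product using (_,_)
  open import Data.Sum using (_⊎_; inj₁; inj₂)
  open import Data.List using (List; []; _∷_; length; map)
  import Data.List.Properties as List
  open import Data.List.Relation.Unary.All as All using (All; []; _∷_)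
  open import Data.List.Relation.Unary.Any as Any using (here; there)
  import Data.List.Relation.Unary.Any.Properties as Any
  open import Data.List.Relation.Unary.AllPairs using ([]; _∷_)
  import Data.List.Membership.Propositional as Propositional
  open import Relation.Nullary using (yes; no)
  open import Relation.Binary.PropositionalEquality as ≡ using (_≡_)

  open FiniteField 𝔽
  open import Algebra.Properties.Ring ring using (-‿involutive; -0#≈0#)
  open import Algebra.Properties.Group +-group using (x∙y⁻¹≈ε⇒x≈y; x≈y⇒x∙y⁻¹≈ε; ∙-cancelˡ; ∙-cancelʳ)
  open import Relation.Binary.Reasoning.Setoid setoid
  open IntegerCoefficientSolver commRing public using (ι; ι-+; ι-‿; solve; Polynomial; _:=_; _:+_; _:-_; _:*_; :-_; con)
  open UniqueLists setoid public
  open WithDecidableEquality _≟_ public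
  open import Data.List.Membership.Setoid setoid using (_∈_)
  open import Data.List.Relation.Unary.Unique.Setoid setoid using (Unique)
  open import Data.List.Membership.Setoid.Properties using (∈-map⁺; ∈-resp-≈)
  import Data.List.Relation.Unary.Unique.Setoid.Properties as Unique

  x-y≈0⇒x≈y : ∀ {x y} → x - y ≈ 0# → x ≈ y
  x-y≈0⇒x≈y = x∙y⁻¹≈ε⇒x≈y _ _

  x≈y⇒x-y≈0 : ∀ {x y} → x ≈ y → x - y ≈ 0#
  x≈y⇒x-y≈0 = x≈y⇒x∙y⁻¹≈ε

  -‿≉0 : ∀ {x} → x ≉ 0# → - x ≉ 0#
  -‿≉0 {x} x≉0 -x≈0 = x≉0 (trans (sym (-‿involutive x)) (trans (-‿cong -x≈0) -0#≈0#))

  +-cancelˡ : ∀ x {y z} → x + y ≈ x + z → y ≈ z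
  +-cancelˡ x = ∙-cancelˡ x _ _

  +-cancelʳ : ∀ x {y z} → y + x ≈ z + x → y ≈ z
  +-cancelʳ x = ∙-cancelʳ x _ _

  ≈-drop : ∀ {X P Q Z} → X ≈ P - Q * Z → Z ≈ 0# → X ≈ P
  ≈-drop {P = P} {Q} X≈P-QZ Z≈0 = trans X≈P-QZ (trans (+-congˡ (-‿cong (trans (*-congˡ Z≈0) (zeroʳ Q))))
                                                        (trans (+-congˡ -0#≈0#) (+-identityʳ P)))

  sum-cancel : ∀ {x y z c} → (x + y) + c ≈ 0# → (x + z) + c ≈ 0# → y ≈ z
  sum-cancel {x} {y} {z} {c} xy≈0 xz≈0 = +-cancelˡ x (+-cancelʳ c (trans xy≈0 (sym xz≈0)))

  *-≈0 : ∀ {x y} → x * y ≈ 0# → x ≈ 0# ⊎ y ≈ 0#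
  *-≈0 {x} {y} xy≈0 with x ≟ 0#
  ... | yes x≈0 = inj₁ x≈0
  ... | no x≉0 = inj₂ (begin
    y               ≈⟨ *-identityˡ y ⟨
    1# * y          ≈⟨ *-congʳ (trans (*-comm _ _) (⁻¹-inv x x≉0)) ⟨
    (x ⁻¹ * x) * y  ≈⟨ *-assoc _ _ _ ⟩
    x ⁻¹ * (x * y)  ≈⟨ *-congˡ xy≈0 ⟩
    x ⁻¹ * 0#       ≈⟨ zeroʳ _ ⟩
    0#              ∎)

  *-≉0 : ∀ {x y} → x ≉ 0# → y ≉ 0# → x * y ≉ 0#
  *-≉0 x≉0 y≉0 xy≈0 with *-≈0 xy≈0
  ... | inj₁ x≈0 = x≉0 x≈0
  ... | inj₂ y≈0 = y≉0 y≈0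

  *-cancelˡ : ∀ {x y z} → x ≉ 0# → x * y ≈ x * z → y ≈ z
  *-cancelˡ {x} {y} {z} x≉0 eq with *-≈0 (trans (solve 3 (λ x y z → x :* (y :- z) := x :* y :- x :* z) refl x y z) (x≈y⇒x-y≈0 eq))
  ... | inj₁ x≈0 = ⊥-elim (x≉0 x≈0)
  ... | inj₂ y-z≈0 = x-y≈0⇒x≈y y-z≈0

  x²≈y²⇒x≈±y : ∀ {x y} → x * x ≈ y * y → x ≈ y ⊎ x ≈ - y
  x²≈y²⇒x≈±y {x} {y} eq with *-≈0 (trans (solve 2 (λ x y → (x :- y) :* (x :+ y) := x :* x :- y :* y) refl x y) (x≈y⇒x-y≈0 eq))
  ... | inj₁ x-y≈0 = inj₁ (x-y≈0⇒x≈y x-y≈0)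
  ... | inj₂ x+y≈0 = inj₂ (x-y≈0⇒x≈y (trans (+-congˡ (-‿involutive y)) x+y≈0))

  -- Lagrange: the cosets x + H partition 𝔽.
  subgroup-∣-order : ∀ {H} → Unique H → 0# ∈ H
    → (∀ {u v} → u Propositional.∈ H → v Propositional.∈ H → v - u ∈ H)
    → length H ∣ order
  subgroup-∣-order {H} H! 0∈H closed =
    Orbits.k∣length {G = λ _ → ⊤ {ℓ = ℓ}} coset (length H)
      (λ _ → Unique.map⁺ setoid setoid (+-cancelˡ _) H!)
      (λ {x} _ → List.length-map (x +_) H)
      (λ {x} _ → ∈-resp-≈ setoid (+-identityʳ x) (∈-map⁺ setoid setoid +-congˡ 0∈H))
      join distinct (All.tabulate _) (All.tabulate λ _ {w} _ → complete w)
    where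
    coset : Carrier → List Carrier
    coset x = map (x +_) H
    join : ∀ {x y w} → ⊤ → ⊤ → w ∈ coset y → w ∈ coset x → y ∈ coset x
    join {x} {y} _ _ w∈y+H w∈x+H with Propositional.find (Any.map⁻ w∈y+H) | Propositional.find (Any.map⁻ w∈x+H)
    ... | u , u∈H , w≈y+u | v , v∈H , w≈x+v = ∈-resp-≈ setoid (sym y≈x+[v-u]) (∈-map⁺ setoid setoid +-congˡ (closed u∈H v∈H))
      where
      y≈x+[v-u] : y ≈ x + (v - u)
      y≈x+[v-u] = begin
        y                ≈⟨ solve 2 (λ y u → y := (y :+ u) :- u) refl y u ⟩
        (y + u) - u      ≈⟨ +-congʳ (trans (sym w≈y+u) w≈x+v) ⟩
        (x + v) - u      ≈⟨ solve 3 (λ x v u → (x :+ v) :- u := x :+ (v :- u)) refl x v u ⟩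
        x + (v - u)      ∎

  1+1≈0⇒2∣order : 1# + 1# ≈ 0# → 2 ∣ order
  1+1≈0⇒2∣order 2≈0 = subgroup-∣-order ((0≉1 ∷ []) ∷ [] ∷ []) (here refl) closed
    where
    0≉1 : 0# ≉ 1#
    0≉1 0≈1 = 1≉0 (sym 0≈1)
    mod2 : ∀ {x y} → x + (1# + 1#) ≈ y → x ≈ y
    mod2 {x} eq = trans (sym (trans (+-congˡ 2≈0) (+-identityʳ x))) eq
    O = con (ℤ.+ 0)
    closed : ∀ {u v} → u Propositional.∈ 0# ∷ 1# ∷ [] → v Propositional.∈ 0# ∷ 1# ∷ [] → v - u ∈ 0# ∷ 1# ∷ []
    closed (here ≡.refl) (here ≡.refl) = here (-‿inverseʳ 0#)
    closed (here ≡.refl) (there (here ≡.refl)) = there (here (solve 1 (λ o → o :- O := o) refl 1#))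
    closed (there (here ≡.refl)) (here ≡.refl) = there (here (mod2 (solve 1 (λ o → (O :- o) :+ (o :+ o) := o) refl 1#)))
    closed (there (here ≡.refl)) (there (here ≡.refl)) = here (-‿inverseʳ 1#)

  three≈0⇒3∣order : three ≈ 0# → 3 ∣ order
  three≈0⇒3∣order 3≈0 = subgroup-∣-order ((0≉1 ∷ 0≉2 ∷ []) ∷ (1≉2 ∷ []) ∷ [] ∷ []) (here refl) closed
    where
    O = con (ℤ.+ 0)
    mod3 : ∀ {x y} → x + three ≈ y → x ≈ y
    mod3 {x} eq = trans (sym (trans (+-congˡ 3≈0) (+-identityʳ x))) eq
    0≉1 : 0# ≉ 1#
    0≉1 0≈1 = 1≉0 (sym 0≈1)
    0≉2 : 0# ≉ 1# + 1#
    0≉2 0≈2 = 1≉0 (begin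
      1#                ≈⟨ solve 1 (λ o → o := (o :+ o :+ o) :- (o :+ o)) refl 1# ⟩
      three - (1# + 1#) ≈⟨ +-cong 3≈0 (-‿cong (sym 0≈2)) ⟩
      0# - 0#           ≈⟨ -‿inverseʳ 0# ⟩
      0#                ∎)
    1≉2 : 1# ≉ 1# + 1#
    1≉2 1≈2 = 1≉0 (sym (+-cancelˡ 1# (trans (+-identityʳ 1#) 1≈2)))
    H = 0# ∷ 1# ∷ 1# + 1# ∷ []
    closed : ∀ {u v} → u Propositional.∈ H → v Propositional.∈ H → v - u ∈ H
    closed (here ≡.refl) (here ≡.refl) = here (-‿inverseʳ 0#)
    closed (here ≡.refl) (there (here ≡.refl)) = there (here (solve 1 (λ o → o :- O := o) refl 1#))
    closed (here ≡.refl) (there (there (here ≡.refl))) = there (there (here (solve 1 (λ o → (o :+ o) :- O := o :+ o) refl 1#)))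
    closed (there (here ≡.refl)) (here ≡.refl) = there (there (here (mod3 (solve 1 (λ o → (O :- o) :+ (o :+ o :+ o) := o :+ o) refl 1#))))
    closed (there (here ≡.refl)) (there (here ≡.refl)) = here (-‿inverseʳ 1#)
    closed (there (here ≡.refl)) (there (there (here ≡.refl))) = there (here (solve 1 (λ o → (o :+ o) :- o := o) refl 1#))
    closed (there (there (here ≡.refl))) (here ≡.refl) = there (here (mod3 (solve 1 (λ o → (O :- (o :+ o)) :+ (o :+ o :+ o) := o) refl 1#)))
    closed (there (there (here ≡.refl))) (there (here ≡.refl)) = there (there (here (mod3 (solve 1 (λ o → (o :- (o :+ o)) :+ (o :+ o :+ o) := o :+ o) refl 1#))))
    closed (there (there (here ≡.refl))) (there (there (here ≡.refl))) = here (-‿inverseʳ (1# + 1#))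

module QuadraticCharacter {c ℓ} (𝔽 : FiniteField c ℓ) where
  open import Level using (_⊔_)
  open import Data.Empty using (⊥-elim)
  open import Data.Product using (_,_; proj₁; proj₂)
  open import Data.List using (List; []; _∷_)
  open import Data.List.Relation.Unary.Any as Any using (Any; any?)
  open import Relation.Nullary using (¬_; yes; no)
  open import Relation.Binary.PropositionalEquality as ≡ using (_≡_; _≢_)

  open FiniteField 𝔽
  open FieldProperties 𝔽
  open Signs
  open import Algebra.Properties.Ring ring using (-1*x≈-x)
  open import Relation.Binary.Reasoning.Setoid setoid

  IsSquare : Carrier → Set (c ⊔ ℓ)
  IsSquare x = Any (λ y → y * y ≈ x) elements

  -- The case split of η, so that η≡⟦χ⟧ holds by computation.
  χ : Carrier → Sign
  χ x with x ≟ 0#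
  ... | yes _ = 0ˢ
  ... | no _ with any? (λ y → (y * y) ≟ x) elements
  ...   | yes _ = 1ˢ
  ...   | no _ = -1ˢ

  ⟦_⟧ : Sign → Carrier
  ⟦ 0ˢ ⟧ = 0#
  ⟦ 1ˢ ⟧ = 1#
  ⟦ -1ˢ ⟧ = - 1#

  η≡⟦χ⟧ : ∀ x → η x ≡ ⟦ χ x ⟧
  η≡⟦χ⟧ x with x ≟ 0#
  ... | yes _ = ≡.refl
  ... | no _ with any? (λ y → (y * y) ≟ x) elements
  ...   | yes _ = ≡.refl
  ...   | no _ = ≡.refl

  data Character (x : Carrier) : Sign → Set (c ⊔ ℓ) where
    vanishing : x ≈ 0# → Character x 0ˢ
    square    : x ≉ 0# → IsSquare x → Character x 1ˢ
    nonsquare : x ≉ 0# → ¬ IsSquare x → Character x -1ˢ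

  character : ∀ x → Character x (χ x)
  character x with x ≟ 0#
  ... | yes x≈0 = vanishing x≈0
  ... | no x≉0 with any? (λ y → (y * y) ≟ x) elements
  ...   | yes □ = square x≉0 □
  ...   | no ¬□ = nonsquare x≉0 ¬□

  character-unique : ∀ {x s t} → Character x s → Character x t → s ≡ t
  character-unique (vanishing _) (vanishing _) = ≡.refl
  character-unique (vanishing x≈0) (square x≉0 _) = ⊥-elim (x≉0 x≈0)
  character-unique (vanishing x≈0) (nonsquare x≉0 _) = ⊥-elim (x≉0 x≈0)
  character-unique (square x≉0 _) (vanishing x≈0) = ⊥-elim (x≉0 x≈0)
  character-unique (square _ _) (square _ _) = ≡.refl
  character-unique (square _ □) (nonsquare _ ¬□) = ⊥-elim (¬□ □)
  character-unique (nonsquare x≉0 _) (vanishing x≈0) = ⊥-elim (x≉0 x≈0)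
  character-unique (nonsquare _ ¬□) (square _ □) = ⊥-elim (¬□ □)
  character-unique (nonsquare _ _) (nonsquare _ _) = ≡.refl

  χ-≡ : ∀ {x s} → Character x s → χ x ≡ s
  χ-≡ {x} = character-unique (character x)

  ≡-χ : ∀ {x s} → χ x ≡ s → Character x s
  ≡-χ {x} χx≡s = ≡.subst (Character x) χx≡s (character x)

  IsSquare-resp : ∀ {x y} → x ≈ y → IsSquare x → IsSquare y
  IsSquare-resp x≈y = Any.map (λ y²≈x → trans y²≈x x≈y)

  character-resp : ∀ {x y s} → x ≈ y → Character x s → Character y s
  character-resp x≈y (vanishing x≈0) = vanishing (trans (sym x≈y) x≈0)
  character-resp x≈y (square x≉0 □) = square (λ y≈0 → x≉0 (trans x≈y y≈0)) (IsSquare-resp x≈y □)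
  character-resp x≈y (nonsquare x≉0 ¬□) = nonsquare (λ y≈0 → x≉0 (trans x≈y y≈0)) (λ □ → ¬□ (IsSquare-resp (sym x≈y) □))

  χ-cong : ∀ {x y} → x ≈ y → χ x ≡ χ y
  χ-cong {x} x≈y = ≡.sym (χ-≡ (character-resp x≈y (character x)))

  χ≡0ˢ⇒≈0 : ∀ {x} → χ x ≡ 0ˢ → x ≈ 0#
  χ≡0ˢ⇒≈0 χx≡0 with ≡-χ χx≡0
  ... | vanishing x≈0 = x≈0

  ≈0⇒χ≡0ˢ : ∀ {x} → x ≈ 0# → χ x ≡ 0ˢ
  ≈0⇒χ≡0ˢ x≈0 = χ-≡ (vanishing x≈0)

  χ≢0ˢ⇒≉0 : ∀ {x} → χ x ≢ 0ˢ → x ≉ 0#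
  χ≢0ˢ⇒≉0 χx≢0 x≈0 = χx≢0 (≈0⇒χ≡0ˢ x≈0)

  ≉0⇒χ≢0ˢ : ∀ {x} → x ≉ 0# → χ x ≢ 0ˢ
  ≉0⇒χ≢0ˢ x≉0 χx≡0 = x≉0 (χ≡0ˢ⇒≈0 χx≡0)

  square-IsSquare : ∀ y → IsSquare (y * y)
  square-IsSquare y = Any.map (λ y≈z → *-cong (sym y≈z) (sym y≈z)) (complete y)

  χ-square : ∀ {y} → y ≉ 0# → χ (y * y) ≡ 1ˢ
  χ-square y≉0 = χ-≡ (square (*-≉0 y≉0 y≉0) (square-IsSquare _))

  χ-square≢-1ˢ : ∀ y → χ (y * y) ≢ -1ˢ
  χ-square≢-1ˢ y χy²≡-1 with ≡-χ χy²≡-1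
  ... | nonsquare _ ¬□ = ¬□ (square-IsSquare y)

  IsSquare-cancel : ∀ {x r t} → r ≉ 0# → x * (r * r) ≈ t * t → IsSquare x
  IsSquare-cancel {x} {r} {t} r≉0 xr²≈t² = IsSquare-resp (begin
    (t * r ⁻¹) * (t * r ⁻¹)        ≈⟨ solve 2 (λ t u → (t :* u) :* (t :* u) := (t :* t) :* (u :* u)) refl t (r ⁻¹) ⟩
    (t * t) * (r ⁻¹ * r ⁻¹)        ≈⟨ *-congʳ xr²≈t² ⟨
    (x * (r * r)) * (r ⁻¹ * r ⁻¹)  ≈⟨ solve 3 (λ x r u → (x :* (r :* r)) :* (u :* u) := x :* ((r :* u) :* (r :* u))) refl x r (r ⁻¹) ⟩
    x * ((r * r ⁻¹) * (r * r ⁻¹))  ≈⟨ *-congˡ (*-cong (⁻¹-inv r r≉0) (⁻¹-inv r r≉0)) ⟩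
    x * (1# * 1#)                  ≈⟨ *-congˡ (*-identityʳ 1#) ⟩
    x * 1#                         ≈⟨ *-identityʳ x ⟩
    x                              ∎) (square-IsSquare (t * r ⁻¹))

  square*square : ∀ {x y} → IsSquare x → IsSquare y → IsSquare (x * y)
  square*square □x □y with Any.satisfied □x | Any.satisfied □y
  ... | r , r²≈x | t , t²≈y = IsSquare-resp
    (trans (solve 2 (λ r t → (r :* t) :* (r :* t) := (r :* r) :* (t :* t)) refl r t) (*-cong r²≈x t²≈y))
    (square-IsSquare (r * t))

  square≉0 : ∀ {r x} → r * r ≈ x → x ≉ 0# → r ≉ 0#
  square≉0 {r} r²≈x x≉0 r≈0 = x≉0 (trans (sym r²≈x) (trans (*-congʳ r≈0) (zeroˡ r)))

  square*nonsquare : ∀ {x y} → x ≉ 0# → IsSquare x → ¬ IsSquare y → ¬ IsSquare (x * y)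
  square*nonsquare {x} {y} x≉0 □x ¬□y □xy with Any.satisfied □x | Any.satisfied □xy
  ... | r , r²≈x | t , t²≈xy =
    ¬□y (IsSquare-cancel (square≉0 r²≈x x≉0) (trans (*-congˡ r²≈x) (trans (*-comm y x) (sym t²≈xy))))

  module _ (1+1≉0 : 1# + 1# ≉ 0#) where
    open import Data.Nat as ℕ using (ℕ; suc; _%_)
    import Data.Nat.Properties as ℕ
    open import Data.Nat.Divisibility using (_∣_; divides)
    open import Data.Nat.DivMod using ([m+kn]%n≡m%n)
    open import Data.Sum using (inj₁; inj₂)
    open import Data.List using (length; filter; map; _++_)
    import Data.List.Properties as List
    open import Data.List.Relation.Unary.All as All using (All; []; _∷_)
    import Data.List.Relation.Unary.All.Properties as All
    open import Data.List.Relation.Unary.Any using (here; there)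
    open import Data.List.Relation.Unary.AllPairs using ([]; _∷_)
    open import Data.List.Membership.Setoid setoid using (_∈_)
    open import Data.List.Membership.Setoid.Properties using (∈-filter⁺; ∈-filter⁻; ∈-resp-≈; ∉-resp-≈)
    open import Data.List.Relation.Unary.Unique.Setoid setoid using (Unique)
    import Data.List.Relation.Unary.Unique.Setoid.Properties as Unique
    open import Algebra.Properties.Ring ring using (-‿involutive)
    open import Data.List.Relation.Binary.Subset.Setoid setoid using (_⊆_)

    x≉-x : ∀ {x} → x ≉ 0# → x ≉ - x
    x≉-x {x} x≉0 x≈-x with *-≈0 (begin
      (1# + 1#) * x  ≈⟨ trans (distribʳ x 1# 1#) (+-cong (*-identityˡ x) (*-identityˡ x)) ⟩
      x + x          ≈⟨ +-congˡ x≈-x ⟩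
      x - x          ≈⟨ -‿inverseʳ x ⟩
      0#             ∎)
    ... | inj₁ 2≈0 = 1+1≉0 2≈0
    ... | inj₂ x≈0 = x≉0 x≈0

    nonzeros : List Carrier
    nonzeros = elements ∖ (0# ∷ [])

    ≉0⇒∈nonzeros : ∀ {x} → x ≉ 0# → x ∈ nonzeros
    ≉0⇒∈nonzeros {x} x≉0 = ∈-∖ (complete x) λ { (here x≈0) → x≉0 x≈0 }

    ∈nonzeros⇒≉0 : ∀ {x} → x ∈ nonzeros → x ≉ 0#
    ∈nonzeros⇒≉0 x∈ x≈0 = proj₂ (∈-filter⁻ setoid (_∉? (0# ∷ [])) (∉-resp-≈ setoid) {xs = elements} x∈) (here x≈0)

    ≉0⇒⊆nonzeros : ∀ {xs} → All (_≉ 0#) xs → xs ⊆ nonzeros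
    ≉0⇒⊆nonzeros xs≉0 x∈ = ≉0⇒∈nonzeros (All.lookupₛ setoid (λ x≈y x≉0 y≈0 → x≉0 (trans x≈y y≈0)) xs≉0 x∈)

    squares : List Carrier
    squares = filter (λ x → χ x ≟ˢ 1ˢ) elements

    χ≡1ˢ-resp : ∀ {x y} → x ≈ y → χ x ≡ 1ˢ → χ y ≡ 1ˢ
    χ≡1ˢ-resp x≈y χx≡1 = ≡.trans (≡.sym (χ-cong x≈y)) χx≡1

    squares! : Unique squares
    squares! = Unique.filter⁺ setoid (λ x → χ x ≟ˢ 1ˢ) distinct

    χ≡1ˢ⇒∈squares : ∀ {x} → χ x ≡ 1ˢ → x ∈ squares
    χ≡1ˢ⇒∈squares {x} = ∈-filter⁺ setoid (λ x → χ x ≟ˢ 1ˢ) χ≡1ˢ-resp (complete x)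

    squares-χ : All (λ x → χ x ≡ 1ˢ) squares
    squares-χ = All.all-filter (λ x → χ x ≟ˢ 1ˢ) elements

    χ≡1ˢ⇒≉0 : ∀ {s} → χ s ≡ 1ˢ → s ≉ 0#
    χ≡1ˢ⇒≉0 χs≡1 s≈0 with ≡-χ χs≡1
    ... | square s≉0 _ = s≉0 s≈0

    -- A square root of x, or the junk value 0# when x is not a square.
    √ : Carrier → Carrier
    √ x with any? (λ y → (y * y) ≟ x) elements
    ... | yes □ = proj₁ (Any.satisfied □)
    ... | no _ = 0#

    √-square : ∀ {x} → χ x ≡ 1ˢ → √ x * √ x ≈ x
    √-square {x} χx≡1 with any? (λ y → (y * y) ≟ x) elements | ≡-χ χx≡1
    ... | yes □ | _ = proj₂ (Any.satisfied □)
    ... | no ¬□ | square _ □ = ⊥-elim (¬□ □)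

    -√-square : ∀ {x} → χ x ≡ 1ˢ → (- √ x) * (- √ x) ≈ x
    -√-square {x} χx≡1 = trans (solve 1 (λ r → (:- r) :* (:- r) := r :* r) refl (√ x)) (√-square χx≡1)

    roots : List Carrier → List Carrier
    roots [] = []
    roots (s ∷ ss) = √ s ∷ - √ s ∷ roots ss

    length-roots : ∀ ss → length (roots ss) ≡ length ss ℕ.+ length ss
    length-roots [] = ≡.refl
    length-roots (s ∷ ss) = ≡.cong suc (≡.trans (≡.cong suc (length-roots ss)) (≡.sym (ℕ.+-suc _ _)))

    roots-avoid : ∀ {r s ss} → r * r ≈ s → All (s ≉_) ss → All (λ s → χ s ≡ 1ˢ) ss → All (r ≉_) (roots ss)
    roots-avoid _ [] [] = []
    roots-avoid {r} {s} r²≈s (s≉s′ ∷ s≉ss) (χs′≡1 ∷ χss≡1) =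
      avoid (√-square χs′≡1) ∷ avoid (-√-square χs′≡1) ∷ roots-avoid r²≈s s≉ss χss≡1
      where
      avoid : ∀ {t} → t * t ≈ _ → r ≉ t
      avoid t²≈s′ r≈t = s≉s′ (trans (sym r²≈s) (trans (*-cong r≈t r≈t) t²≈s′))

    roots! : ∀ {ss} → Unique ss → All (λ s → χ s ≡ 1ˢ) ss → Unique (roots ss)
    roots! [] [] = []
    roots! {s ∷ _} (s≉ss ∷ ss!) (χs≡1 ∷ χss≡1) =
      (x≉-x (square≉0 (√-square χs≡1) (χ≡1ˢ⇒≉0 χs≡1)) ∷ roots-avoid (√-square χs≡1) s≉ss χss≡1)
      ∷ roots-avoid (-√-square χs≡1) s≉ss χss≡1 ∷ roots! ss! χss≡1

    roots-≉0 : ∀ ss → All (λ s → χ s ≡ 1ˢ) ss → All (_≉ 0#) (roots ss)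
    roots-≉0 [] [] = []
    roots-≉0 (s ∷ ss) (χs≡1 ∷ χss≡1) =
      square≉0 (√-square χs≡1) (χ≡1ˢ⇒≉0 χs≡1) ∷ square≉0 (-√-square χs≡1) (χ≡1ˢ⇒≉0 χs≡1) ∷ roots-≉0 ss χss≡1

    ∈-roots : ∀ {x ss} → x * x ∈ ss → All (λ s → χ s ≡ 1ˢ) ss → x ∈ roots ss
    ∈-roots {x} (here x²≈s) (χs≡1 ∷ _) with x²≈y²⇒x≈±y (trans x²≈s (sym (√-square χs≡1)))
    ... | inj₁ x≈√s = here x≈√s
    ... | inj₂ x≈-√s = there (here x≈-√s)
    ∈-roots (there x²∈ss) (_ ∷ χss≡1) = there (there (∈-roots x²∈ss χss≡1))

    |nonzeros|≡|squares|+|squares| : length nonzeros ≡ length squares ℕ.+ length squares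
    |nonzeros|≡|squares|+|squares| = ≡.trans
      (length-≡-⊆⊇ nonzeros! (roots! squares! squares-χ)
        (λ x∈ → ∈-roots (χ≡1ˢ⇒∈squares (χ-square (∈nonzeros⇒≉0 x∈))) squares-χ)
        (≉0⇒⊆nonzeros (roots-≉0 squares squares-χ)))
      (length-roots squares)
      where
      nonzeros! : Unique nonzeros
      nonzeros! = Unique.filter⁺ setoid (_∉? (0# ∷ [])) distinct

    -- Otherwise y, the nonzero squares and x times the nonzero squares would be
    -- 2·|squares| + 1 distinct nonzero elements.
    nonsquare*nonsquare : ∀ {x y} → x ≉ 0# → ¬ IsSquare x → y ≉ 0# → ¬ IsSquare y → IsSquare (x * y)
    nonsquare*nonsquare {x} {y} x≉0 ¬□x y≉0 ¬□y with any? (λ t → (t * t) ≟ (x * y)) elements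
    ... | yes □xy = □xy
    ... | no ¬□xy = ⊥-elim (ℕ.<-irrefl ≡.refl (ℕ.≤-trans (ℕ.≤-reflexive |candidates|)
        (ℕ.≤-trans (length-mono-⊆ candidates! (≉0⇒⊆nonzeros candidates≉0)) (ℕ.≤-reflexive |nonzeros|≡|squares|+|squares|))))
      where
      import Data.List.Relation.Unary.AllPairs.Properties as AllPairs
      xsquares = map (x *_) squares
      candidates = y ∷ squares ++ xsquares
      |candidates| : suc (length squares ℕ.+ length squares) ≡ length candidates
      |candidates| = ≡.cong suc (≡.trans (≡.cong (length squares ℕ.+_) (≡.sym (List.length-map (x *_) squares)))
                                         (≡.sym (List.length-++ squares)))
      x√s-square : ∀ {s} → χ s ≡ 1ˢ → (x * √ s) * (x * √ s) ≈ x * (x * s)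
      x√s-square {s} χs≡1 = trans (solve 2 (λ x r → (x :* r) :* (x :* r) := x :* (x :* (r :* r))) refl x (√ s))
                                  (*-congˡ (*-congˡ (√-square χs≡1)))
      y≉square : ∀ {s} → χ s ≡ 1ˢ → y ≉ s
      y≉square χs≡1 y≈s with ≡-χ χs≡1
      ... | square _ □s = ¬□y (IsSquare-resp (sym y≈s) □s)
      y≉xsquare : ∀ {s} → χ s ≡ 1ˢ → y ≉ x * s
      y≉xsquare {s} χs≡1 y≈xs = ¬□xy (IsSquare-resp (trans (x√s-square χs≡1) (*-congˡ (sym y≈xs))) (square-IsSquare _))
      square≉xsquare : ∀ {s t} → χ s ≡ 1ˢ → χ t ≡ 1ˢ → s ≉ x * t
      square≉xsquare {s} {t} χs≡1 χt≡1 s≈xt = ¬□x (IsSquare-cancel (square≉0 (√-square χt≡1) (χ≡1ˢ⇒≉0 χt≡1))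
        (trans (*-congˡ (√-square χt≡1)) (trans (sym s≈xt) (sym (√-square χs≡1)))))
      candidates! : Unique candidates
      candidates! = All.++⁺ (All.map y≉square squares-χ) (All.map⁺ (All.map y≉xsquare squares-χ))
                  ∷ AllPairs.++⁺ squares! (Unique.map⁺ setoid setoid (*-cancelˡ x≉0) squares!)
                      (All.map (λ χs≡1 → All.map⁺ (All.map (square≉xsquare χs≡1) squares-χ)) squares-χ)
      candidates≉0 : All (_≉ 0#) candidates
      candidates≉0 = y≉0 ∷ All.++⁺ (All.map χ≡1ˢ⇒≉0 squares-χ) (All.map⁺ (All.map (λ χs≡1 → *-≉0 x≉0 (χ≡1ˢ⇒≉0 χs≡1)) squares-χ))

    χ-* : ∀ x y → χ (x * y) ≡ χ x ·ˢ χ y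
    χ-* x y with χ x | character x | χ y | character y
    ... | _ | vanishing x≈0 | _ | _ = ≈0⇒χ≡0ˢ (trans (*-congʳ x≈0) (zeroˡ y))
    ... | _ | square _ _ | _ | vanishing y≈0 = ≈0⇒χ≡0ˢ (trans (*-congˡ y≈0) (zeroʳ x))
    ... | _ | nonsquare _ _ | _ | vanishing y≈0 = ≈0⇒χ≡0ˢ (trans (*-congˡ y≈0) (zeroʳ x))
    ... | _ | square x≉0 □x | _ | square y≉0 □y = χ-≡ (square (*-≉0 x≉0 y≉0) (square*square □x □y))
    ... | _ | square x≉0 □x | _ | nonsquare y≉0 ¬□y = χ-≡ (nonsquare (*-≉0 x≉0 y≉0) (square*nonsquare x≉0 □x ¬□y))
    ... | _ | nonsquare x≉0 ¬□x | _ | square y≉0 □y =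
      χ-≡ (nonsquare (*-≉0 x≉0 y≉0) (λ □xy → square*nonsquare y≉0 □y ¬□x (IsSquare-resp (*-comm x y) □xy)))
    ... | _ | nonsquare x≉0 ¬□x | _ | nonsquare y≉0 ¬□y = χ-≡ (square (*-≉0 x≉0 y≉0) (nonsquare*nonsquare x≉0 ¬□x y≉0 ¬□y))

    ±_ : Carrier → List Carrier
    ± s = s ∷ - s ∷ []

    ±-join : ∀ {x y w} → w ∈ ± y → w ∈ ± x → y ∈ ± x
    ±-join (here w≈y) (here w≈x) = here (trans (sym w≈y) w≈x)
    ±-join (here w≈y) (there (here w≈-x)) = there (here (trans (sym w≈y) w≈-x))
    ±-join {y = y} (there (here w≈-y)) (here w≈x) =
      there (here (trans (sym (-‿involutive y)) (-‿cong (trans (sym w≈-y) w≈x))))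
    ±-join {x} {y} (there (here w≈-y)) (there (here w≈-x)) =
      here (trans (sym (-‿involutive y)) (trans (-‿cong (trans (sym w≈-y) w≈-x)) (-‿involutive x)))

    -- With -1 a square, negation pairs up the nonzero squares.
    2∣|squares| : χ (- 1#) ≡ 1ˢ → 2 ∣ length squares
    2∣|squares| χ-1≡1 = Orbits.k∣length {G = λ s → χ s ≡ 1ˢ} ±_ 2
      (λ χs≡1 → (x≉-x (χ≡1ˢ⇒≉0 χs≡1) ∷ []) ∷ [] ∷ []) (λ _ → ≡.refl) (λ _ → here refl) (λ _ _ → ±-join)
      squares! squares-χ (All.map (λ χs≡1 {w} w∈±s → χ≡1ˢ⇒∈squares (±-square χs≡1 w∈±s)) squares-χ)
      where
      ±-square : ∀ {s w} → χ s ≡ 1ˢ → w ∈ ± s → χ w ≡ 1ˢ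
      ±-square χs≡1 (here w≈s) = χ≡1ˢ-resp (sym w≈s) χs≡1
      ±-square {s} χs≡1 (there (here w≈-s)) = χ≡1ˢ-resp (sym (trans w≈-s (sym (-1*x≈-x s))))
        (≡.trans (χ-* (- 1#) s) (≡.cong₂ _·ˢ_ χ-1≡1 χs≡1))

    |nonzeros|+1≡order : length nonzeros ℕ.+ 1 ≡ order
    |nonzeros|+1≡order = length-∖ distinct ([] ∷ []) λ { (here x≈0) → ∈-resp-≈ setoid (sym x≈0) (complete 0#) }

    χ-1≡1ˢ⇒order%4≡1 : χ (- 1#) ≡ 1ˢ → order % 4 ≡ 1
    χ-1≡1ˢ⇒order%4≡1 χ-1≡1 with 2∣|squares| χ-1≡1
    ... | divides m |squares|≡m*2 = ≡.trans (≡.cong (_% 4) order≡1+m*4) ([m+kn]%n≡m%n 1 m 4)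
      where
      |nonzeros|≡m*4 : length nonzeros ≡ m ℕ.* 4
      |nonzeros|≡m*4 = ≡.trans |nonzeros|≡|squares|+|squares|
        (≡.trans (≡.cong₂ ℕ._+_ |squares|≡m*2 |squares|≡m*2) (≡.sym (ℕ.*-distribˡ-+ m 2 2)))
      order≡1+m*4 : order ≡ 1 ℕ.+ m ℕ.* 4
      order≡1+m*4 = ≡.trans (≡.sym |nonzeros|+1≡order) (≡.trans (ℕ.+-comm (length nonzeros) 1) (≡.cong suc |nonzeros|≡m*4))

    χ-1≡-1ˢ : order % 4 ≢ 1 → χ (- 1#) ≡ -1ˢ
    χ-1≡-1ˢ order%4≢1 with χ (- 1#) in χ-1≡s
    ... | 0ˢ = ⊥-elim (-‿≉0 1≉0 (χ≡0ˢ⇒≈0 χ-1≡s))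
    ... | 1ˢ = ⊥-elim (order%4≢1 (χ-1≡1ˢ⇒order%4≡1 χ-1≡s))
    ... | -1ˢ = ≡.refl

    χ-‿ : χ (- 1#) ≡ -1ˢ → ∀ x → χ (- x) ≡ -ˢ χ x
    χ-‿ χ-1≡-1 x = ≡.trans (χ-cong (sym (-1*x≈-x x))) (≡.trans (χ-* (- 1#) x) (≡.cong (_·ˢ χ x) χ-1≡-1))

module DifferentialUniformity {c ℓ} (𝔽 : FiniteField c ℓ) where
  open import Data.Nat as ℕ using (ℕ; _≤_)
  import Data.Nat.Properties as ℕ
  open import Data.Integer as ℤ using (ℤ; +_; -[1+_])
  open import Data.Empty using (⊥-elim)
  open import Data.Sum using (inj₁; inj₂)
  open import Data.Product using (_×_; _,_; proj₁; proj₂)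
  open import Data.List using (List; []; _∷_; filter)
  open import Relation.Binary.PropositionalEquality as ≡ using (_≡_; _≢_)

  open FiniteField 𝔽
  open FieldProperties 𝔽
  open QuadraticCharacter 𝔽
  open Signs
  open SignPatterns
  open import Algebra.Properties.Ring ring using (-‿distribʳ-*)
  open import Relation.Binary.Reasoning.Setoid setoid

  𝟎 𝟐 𝟑 𝟒 : ∀ {n} → Polynomial n
  𝟎 = con (+ 0)
  𝟐 = con (+ 2)
  𝟑 = con (+ 3)
  𝟒 = con (+ 4)

  module _ (1+1≉0 : 1# + 1# ≉ 0#) (three≉0 : three ≉ 0#) (χ-1≡-1 : χ (- 1#) ≡ -1ˢ) where

    three≈3 : three ≈ ι (+ 3)
    three≈3 = sym (trans (+-congˡ (+-congˡ (+-identityʳ 1#))) (sym (+-assoc 1# 1# 1#)))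

    2≉0 : ι (+ 2) ≉ 0#
    2≉0 2≈0 = 1+1≉0 (trans (+-congˡ (sym (+-identityʳ 1#))) 2≈0)

    3≉0 : ι (+ 3) ≉ 0#
    3≉0 3≈0 = three≉0 (trans three≈3 3≈0)

    4≉0 : ι (+ 4) ≉ 0#
    4≉0 4≈0 = *-≉0 2≉0 2≉0 (trans (solve 0 (𝟐 :* 𝟐 := 𝟒) refl) 4≈0)

    d : Carrier
    d = ι (+ 2) * three ⁻¹

    d≉0 : d ≉ 0#
    d≉0 = *-≉0 2≉0 λ t≈0 → 1≉0 (trans (sym (⁻¹-inv three three≉0)) (trans (*-congˡ t≈0) (zeroʳ three)))

    coef : Sign → Carrier
    coef 0ˢ = 0#
    coef 1ˢ = ι (+ 2) * d
    coef -1ˢ = d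

    1-3*three⁻¹≈0 : 1# - ι (+ 3) * three ⁻¹ ≈ 0#
    1-3*three⁻¹≈0 = x≈y⇒x-y≈0 (sym (trans (*-congʳ (sym three≈3)) (⁻¹-inv three three≉0)))

    F≈coef : ∀ x → F₂,⅓ x ≈ coef (χ x) * (x * x)
    F≈coef x rewrite η≡⟦χ⟧ x with χ x | character x
    ... | _ | vanishing x≈0 = trans (*-congʳ (trans (*-congʳ x≈0) (zeroˡ x))) (trans (zeroˡ _) (sym (zeroˡ _)))
    ... | _ | square _ _ = trans (*-comm _ _) (*-congʳ (begin
      1# + three ⁻¹ * 1#         ≈⟨ +-congˡ (*-identityʳ _) ⟩
      1# + three ⁻¹              ≈⟨ solve 2 (λ o t → o :+ t := 𝟐 :* (𝟐 :* t) :+ (o :- 𝟑 :* t)) refl 1# (three ⁻¹) ⟩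
      ι (+ 2) * d + (1# - ι (+ 3) * three ⁻¹) ≈⟨ +-congˡ 1-3*three⁻¹≈0 ⟩
      ι (+ 2) * d + 0#           ≈⟨ +-identityʳ _ ⟩
      ι (+ 2) * d                ∎))
    ... | _ | nonsquare _ _ = trans (*-comm _ _) (*-congʳ (begin
      1# + three ⁻¹ * - 1#       ≈⟨ +-congˡ (trans (sym (-‿distribʳ-* _ 1#)) (-‿cong (*-identityʳ _))) ⟩
      1# - three ⁻¹              ≈⟨ solve 2 (λ o t → o :- t := 𝟐 :* t :+ (o :- 𝟑 :* t)) refl 1# (three ⁻¹) ⟩
      d + (1# - ι (+ 3) * three ⁻¹) ≈⟨ +-congˡ 1-3*three⁻¹≈0 ⟩
      d + 0#                     ≈⟨ +-identityʳ _ ⟩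
      d                          ∎))

    -- F₂,⅓ (x + a) - F₂,⅓ x on a class, cf. F≈coef.
    Δ : ∀ {n} → Polynomial n → Polynomial n → Polynomial n → Polynomial n → Polynomial n
    Δ c₁ c₂ x a = c₁ :* ((x :+ a) :* (x :+ a)) :- c₂ :* (x :* x)

    W : ∀ {n} → Polynomial n → Polynomial n → Polynomial n
    W δ a = δ :* (a :* a)

    χ-≈* : ∀ {X K Y} → X ≈ K * Y → χ X ≡ χ K ·ˢ χ Y
    χ-≈* {X} {K} {Y} X≈KY = ≡.trans (χ-cong X≈KY) (χ-* 1+1≉0 K Y)

    module Solutions {a : Carrier} (a≉0 : a ≉ 0#) (b : Carrier) where
      open import Data.Product.Properties using (≡-dec)
      open import Data.List.Relation.Unary.All as All using (All)
      import Data.List.Relation.Unary.All.Properties as All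
      open import Data.List.Relation.Unary.Unique.Setoid setoid using (Unique)
      import Data.List.Relation.Unary.Unique.Setoid.Properties as Unique

      w : Carrier
      w = d * (a * a)

      E : ℤ → Carrier
      E k = b + ι k * w

      π : Pattern
      π = signs (χ d) (χ (E -[1+ 1 ])) (χ (E -[1+ 0 ])) (χ (E (+ 1))) (χ (E (+ 2)))

      key : Carrier → Sign × Sign
      key x = χ (x + a) , χ x

      solutions : List Carrier
      solutions = filter (λ x → (F₂,⅓ (x + a) - F₂,⅓ x) ≟ b) elements

      Solution : Sign × Sign → Carrier → Set ℓ
      Solution k x = F₂,⅓ (x + a) - F₂,⅓ x ≈ b × key x ≡ k

      open FilterCounting (≡-dec _≟ˢ_ _≟ˢ_) key public using (count; length≤Σcount; Σcount≤)

      module _ (k : Sign × Sign) where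
        solutionsIn : List Carrier
        solutionsIn = filter (λ x → ≡-dec _≟ˢ_ _≟ˢ_ (key x) k) solutions

        solutionsIn! : Unique solutionsIn
        solutionsIn! = Unique.filter⁺ setoid _ (Unique.filter⁺ setoid _ distinct)

        solutionsIn-sound : All (Solution k) solutionsIn
        solutionsIn-sound = All.zip (All.filter⁺ _ (All.all-filter _ elements) , All.all-filter _ solutions)

        count≤-atMostOne : ∀ {n} → (∀ {x} → Solution k x → 1 ≤ n) → (∀ {x y} → Solution k x → Solution k y → x ≈ y)
          → count k solutions ≤ n
        count≤-atMostOne = length≤-of-atMostOne solutionsIn! solutionsIn-sound

        count≤-atMostTwo : ∀ {n} → (∀ {x} → Solution k x → 1 ≤ n)
          → (∀ {x y} → Solution k x → Solution k y → x ≉ y → 2 ≤ n)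
          → (∀ {x y z} → Solution k x → Solution k y → Solution k z → x ≉ y → x ≉ z → y ≈ z)
          → count k solutions ≤ n
        count≤-atMostTwo = length≤-of-atMostTwo solutionsIn! solutionsIn-sound

      module _ {σ τ x} (sol : Solution (σ , τ) x) where
        χ[x+a]≡σ : χ (x + a) ≡ σ
        χ[x+a]≡σ = ≡.cong proj₁ (proj₂ sol)

        χx≡τ : χ x ≡ τ
        χx≡τ = ≡.cong proj₂ (proj₂ sol)

        equation : b ≈ coef σ * ((x + a) * (x + a)) - coef τ * (x * x)
        equation with proj₂ sol
        ... | ≡.refl = trans (sym (proj₁ sol)) (+-cong (F≈coef (x + a)) (-‿cong (F≈coef x)))

        E≈ : ∀ k {R} → coef σ * ((x + a) * (x + a)) - coef τ * (x * x) + ι k * w ≈ R → E k ≈ R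
        E≈ k eq = trans (+-congʳ equation) eq

      χ≡0ˢ-via : ∀ {X K Y} → X ≈ K * Y → Y ≈ 0# → χ X ≡ 0ˢ
      χ≡0ˢ-via {K = K} X≈KY Y≈0 = ≈0⇒χ≡0ˢ (trans X≈KY (trans (*-congˡ Y≈0) (zeroʳ K)))

      x≈0 : ∀ {σ x} → Solution (σ , 0ˢ) x → x ≈ 0#
      x≈0 sol = χ≡0ˢ⇒≈0 (χx≡τ sol)

      x+a≈0 : ∀ {τ x} → Solution (0ˢ , τ) x → x + a ≈ 0#
      x+a≈0 sol = χ≡0ˢ⇒≈0 (χ[x+a]≡σ sol)

      x≈-a-unique : ∀ {τ x y} → Solution (0ˢ , τ) x → Solution (0ˢ , τ) y → x ≈ y
      x≈-a-unique solx soly = +-cancelʳ a (trans (x+a≈0 solx) (sym (x+a≈0 soly)))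

      count₀₀ : count (0ˢ , 0ˢ) solutions ≤ 0
      count₀₀ = count≤-atMostOne (0ˢ , 0ˢ) (λ sol → ⊥-elim (a≉0 (a≈0 sol))) (λ sol _ → ⊥-elim (a≉0 (a≈0 sol)))
        where
        a≈0 : ∀ {x} → Solution (0ˢ , 0ˢ) x → a ≈ 0#
        a≈0 {x} sol = begin
          a              ≈⟨ solve 2 (λ x a → a := (x :+ a) :- x) refl x a ⟩
          (x + a) - x    ≈⟨ +-cong (x+a≈0 sol) (-‿cong (x≈0 sol)) ⟩
          0# - 0#        ≈⟨ -‿inverseʳ 0# ⟩
          0#             ∎

      count₊₀ : count (1ˢ , 0ˢ) solutions ≤ bound (1ˢ , 0ˢ) π
      count₊₀ = count≤-atMostOne (1ˢ , 0ˢ)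
        (λ {x} sol → [≡]-positive _ _ (χ≡0ˢ-via (E≈ sol -[1+ 1 ]
          (solve 3 (λ x a δ → Δ (𝟐 :* δ) 𝟎 x a :+ con -[1+ 1 ] :* W δ a := ((𝟐 :* δ) :* (x :+ 𝟐 :* a)) :* x) refl x a d))
          (x≈0 sol)))
        (λ solx soly → trans (x≈0 solx) (sym (x≈0 soly)))

      count₋₀ : count (-1ˢ , 0ˢ) solutions ≤ bound (-1ˢ , 0ˢ) π
      count₋₀ = count≤-atMostOne (-1ˢ , 0ˢ)
        (λ {x} sol → [≡]-positive _ _ (χ≡0ˢ-via (E≈ sol -[1+ 0 ]
          (solve 3 (λ x a δ → Δ δ 𝟎 x a :+ con -[1+ 0 ] :* W δ a := (δ :* (x :+ 𝟐 :* a)) :* x) refl x a d))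
          (x≈0 sol)))
        (λ solx soly → trans (x≈0 solx) (sym (x≈0 soly)))

      count₀₊ : count (0ˢ , 1ˢ) solutions ≤ bound (0ˢ , 1ˢ) π
      count₀₊ = count≤-atMostOne (0ˢ , 1ˢ)
        (λ {x} sol → [≡]-positive _ _ (χ≡0ˢ-via (E≈ sol (+ 2)
          (solve 3 (λ x a δ → Δ 𝟎 (𝟐 :* δ) x a :+ 𝟐 :* W δ a := ((𝟐 :* δ) :* (a :- x)) :* (x :+ a)) refl x a d))
          (x+a≈0 sol)))
        x≈-a-unique

      count₀₋ : count (0ˢ , -1ˢ) solutions ≤ bound (0ˢ , -1ˢ) π
      count₀₋ = count≤-atMostOne (0ˢ , -1ˢ)
        (λ {x} sol → [≡]-positive _ _ (χ≡0ˢ-via (E≈ sol (+ 1)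
          (solve 3 (λ x a δ → Δ 𝟎 δ x a :+ con (+ 1) :* W δ a := (δ :* (a :- x)) :* (x :+ a)) refl x a d))
          (x+a≈0 sol)))
        x≈-a-unique

      module Linear {σ : Sign} (σ≢0 : σ ≢ 0ˢ) (K : Carrier) (K≉0 : K ≉ 0#) (k₊ k₋ : ℤ)
        (E₊≈ : ∀ {x} → Solution (σ , σ) x → E k₊ ≈ K * (x + a))
        (E₋≈ : ∀ {x} → Solution (σ , σ) x → E k₋ ≈ K * x) where

        signs-agree : ∀ {x} → Solution (σ , σ) x → χ (E k₊) ≡ χ (E k₋)
        signs-agree sol = ≡.trans (χ-≈* (E₊≈ sol))
          (≡.trans (≡.cong (χ K ·ˢ_) (≡.trans (χ[x+a]≡σ sol) (≡.sym (χx≡τ sol)))) (≡.sym (χ-≈* (E₋≈ sol))))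

        sign≢0 : ∀ {x} → Solution (σ , σ) x → χ (E k₊) ≢ 0ˢ
        sign≢0 sol = ≉0⇒χ≢0ˢ λ E₊≈0 → *-≉0 K≉0 (χ≢0ˢ⇒≉0 (≡.subst (_≢ 0ˢ) (≡.sym (χ[x+a]≡σ sol)) σ≢0))
          (trans (sym (E₊≈ sol)) E₊≈0)

        unique : ∀ {x y} → Solution (σ , σ) x → Solution (σ , σ) y → x ≈ y
        unique solx soly = *-cancelˡ K≉0 (trans (sym (E₋≈ solx)) (E₋≈ soly))

      count₊₊ : count (1ˢ , 1ˢ) solutions ≤ bound (1ˢ , 1ˢ) π
      count₊₊ = count≤-atMostOne (1ˢ , 1ˢ) (λ sol → [≡≢0]-positive _ _ (signs-agree sol) (sign≢0 sol)) unique
        where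
        open Linear {1ˢ} (λ ()) (ι (+ 4) * d * a) (*-≉0 (*-≉0 4≉0 d≉0) a≉0) (+ 2) -[1+ 1 ]
          (λ {x} sol → E≈ sol (+ 2) (solve 3 (λ x a δ → Δ (𝟐 :* δ) (𝟐 :* δ) x a :+ 𝟐 :* W δ a := 𝟒 :* δ :* a :* (x :+ a)) refl x a d))
          (λ {x} sol → E≈ sol -[1+ 1 ] (solve 3 (λ x a δ → Δ (𝟐 :* δ) (𝟐 :* δ) x a :+ con -[1+ 1 ] :* W δ a := 𝟒 :* δ :* a :* x) refl x a d))

      count₋₋ : count (-1ˢ , -1ˢ) solutions ≤ bound (-1ˢ , -1ˢ) π
      count₋₋ = count≤-atMostOne (-1ˢ , -1ˢ) (λ sol → [≡≢0]-positive _ _ (signs-agree sol) (sign≢0 sol)) unique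
        where
        open Linear { -1ˢ} (λ ()) (ι (+ 2) * d * a) (*-≉0 (*-≉0 2≉0 d≉0) a≉0) (+ 1) -[1+ 0 ]
          (λ {x} sol → E≈ sol (+ 1) (solve 3 (λ x a δ → Δ δ δ x a :+ con (+ 1) :* W δ a := 𝟐 :* δ :* a :* (x :+ a)) refl x a d))
          (λ {x} sol → E≈ sol -[1+ 0 ] (solve 3 (λ x a δ → Δ δ δ x a :+ con -[1+ 0 ] :* W δ a := 𝟐 :* δ :* a :* x) refl x a d))

      -- Vieta: the difference of the equations for x and y factors through x - y.
      roots-sum : ∀ {K x y e Lx Ly} → K ≉ 0# → b ≈ Lx → b ≈ Ly → Lx - Ly ≈ (K * (x - y)) * ((x + y) + e) → x ≉ y
        → (x + y) + e ≈ 0#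
      roots-sum K≉0 b≈Lx b≈Ly Lx-Ly≈ x≉y with *-≈0 (trans (sym Lx-Ly≈) (x≈y⇒x-y≈0 (trans (sym b≈Lx) b≈Ly)))
      ... | inj₂ Z≈0 = Z≈0
      ... | inj₁ K[x-y]≈0 with *-≈0 K[x-y]≈0
      ...   | inj₁ K≈0 = ⊥-elim (K≉0 K≈0)
      ...   | inj₂ x-y≈0 = ⊥-elim (x≉y (x-y≈0⇒x≈y x-y≈0))

      χ≡χd : ∀ {X Y} → X ≈ d * Y → χ Y ≡ 1ˢ → χ X ≡ χ d
      χ≡χd X≈dY χY≡1 = ≡.trans (χ-≈* X≈dY) (≡.trans (≡.cong (χ d ·ˢ_) χY≡1) (·ˢ-identityʳ (χ d)))

      -- At every root d · D is the square of d x + c, so η(d) η(D) ≠ -1, and D = 0 leaves one root.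
      module Quadratic {σ τ : Sign} (D c e : Carrier) (u v v′ : Sign) (u≡χD : u ≡ χ D)
        (discriminant : ∀ {x} → Solution (σ , τ) x → d * D ≈ (d * x + c) * (d * x + c))
        (vieta : ∀ {x y} → Solution (σ , τ) x → Solution (σ , τ) y → x ≉ y → (x + y) + e ≈ 0#)
        (two-roots : ∀ {x y} → Solution (σ , τ) x → Solution (σ , τ) y → (x + y) + e ≈ 0# → v ≡ χ d × v′ ≡ χ d)
        where

        count≤ : count (σ , τ) solutions ≤ quadraticBound (χ d) u v v′
        count≤ = count≤-atMostTwo (σ , τ)
          (λ sol → quadraticBound-one _ u v v′ (δu≢-1 sol))
          (λ solx soly x≉y → quadraticBound-two _ u v v′ (δu≢-1 solx) (u≢0 solx soly x≉y)
             (proj₁ (two-roots solx soly (vieta solx soly x≉y))) (proj₂ (two-roots solx soly (vieta solx soly x≉y))))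
          (λ solx soly solz x≉y x≉z → sum-cancel (vieta solx soly x≉y) (vieta solx solz x≉z))
          where
          δu≢-1 : ∀ {x} → Solution (σ , τ) x → χ d ·ˢ u ≢ -1ˢ
          δu≢-1 {x} sol δu≡-1 = χ-square≢-1ˢ (d * x + c) (≡.trans (≡.sym (χ-cong (discriminant sol)))
            (≡.trans (χ-* 1+1≉0 d D) (≡.trans (≡.cong (χ d ·ˢ_) (≡.sym u≡χD)) δu≡-1)))
          u≢0 : ∀ {x y} → Solution (σ , τ) x → Solution (σ , τ) y → x ≉ y → u ≢ 0ˢ
          u≢0 {x} {y} solx soly x≉y u≡0 = x≉y (*-cancelˡ d≉0 (+-cancelʳ c (trans (root solx) (sym (root soly)))))
            where
            D≈0 : D ≈ 0#
            D≈0 = χ≡0ˢ⇒≈0 (≡.trans (≡.sym u≡χD) u≡0)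
            square≈0 : ∀ {r} → r * r ≈ 0# → r ≈ 0#
            square≈0 r²≈0 with *-≈0 r²≈0
            ... | inj₁ r≈0 = r≈0
            ... | inj₂ r≈0 = r≈0
            root : ∀ {z} → Solution (σ , τ) z → d * z + c ≈ 0#
            root sol = square≈0 (trans (sym (discriminant sol)) (trans (*-congˡ D≈0) (zeroʳ d)))

      χ-*≡1ˢ : ∀ {x y s} → χ x ≡ s → χ y ≡ s → s ·ˢ s ≡ 1ˢ → χ (x * y) ≡ 1ˢ
      χ-*≡1ˢ {x} {y} χx≡s χy≡s ss≡1 = ≡.trans (χ-* 1+1≉0 x y) (≡.trans (≡.cong₂ _·ˢ_ χx≡s χy≡s) ss≡1)

      count₊₋ : count (1ˢ , -1ˢ) solutions ≤ bound (1ˢ , -1ˢ) π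
      count₊₋ = Quadratic.count≤ (E (+ 2)) (ι (+ 2) * d * a) (ι (+ 4) * a) _ _ _ ≡.refl
        (λ {x} sol → trans (*-congˡ (+-congʳ (equation sol)))
           (solve 3 (λ x a δ → δ :* (Δ (𝟐 :* δ) δ x a :+ 𝟐 :* W δ a) := (δ :* x :+ 𝟐 :* δ :* a) :* (δ :* x :+ 𝟐 :* δ :* a)) refl x a d))
        (λ {x} {y} solx soly → roots-sum d≉0 (equation solx) (equation soly)
           (solve 4 (λ x y a δ → Δ (𝟐 :* δ) δ x a :- Δ (𝟐 :* δ) δ y a := (δ :* (x :- y)) :* (x :+ y :+ 𝟒 :* a)) refl x y a d))
        (λ {x} {y} solx soly Z≈0 →
           ≡.trans (≡.sym (χ-‿ 1+1≉0 χ-1≡-1 _)) (χ≡χd (≈-drop (trans (-‿cong (+-congʳ (equation solx)))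
             (solve 4 (λ x y a δ → :- (Δ (𝟐 :* δ) δ x a :+ con -[1+ 1 ] :* W δ a) := δ :* (x :* y) :- (δ :* x) :* (x :+ y :+ 𝟒 :* a))
               refl x y a d)) Z≈0) (χ-*≡1ˢ (χx≡τ solx) (χx≡τ soly) ≡.refl))
         , ≡.trans (≡.sym (χ-‿ 1+1≉0 χ-1≡-1 _)) (χ≡χd (≈-drop (trans (-‿cong (+-congʳ (equation solx)))
             (solve 4 (λ x y a δ → :- (Δ (𝟐 :* δ) δ x a :+ con (+ 1) :* W δ a)
                                  := δ :* ((x :+ a) :* (y :+ a)) :- (δ :* (x :+ a)) :* (x :+ y :+ 𝟒 :* a))
               refl x y a d)) Z≈0) (χ-*≡1ˢ (χ[x+a]≡σ solx) (χ[x+a]≡σ soly) ≡.refl)))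

      count₋₊ : count (-1ˢ , 1ˢ) solutions ≤ bound (-1ˢ , 1ˢ) π
      count₋₊ = Quadratic.count≤ (- E -[1+ 1 ]) (- (d * a)) (- (ι (+ 2) * a)) _ _ _ (≡.sym (χ-‿ 1+1≉0 χ-1≡-1 _))
        (λ {x} sol → trans (*-congˡ (-‿cong (+-congʳ (equation sol))))
           (solve 3 (λ x a δ → δ :* (:- (Δ δ (𝟐 :* δ) x a :+ con -[1+ 1 ] :* W δ a))
                              := (δ :* x :+ :- (δ :* a)) :* (δ :* x :+ :- (δ :* a))) refl x a d))
        (λ {x} {y} solx soly → roots-sum (-‿≉0 d≉0) (equation solx) (equation soly)
           (solve 4 (λ x y a δ → Δ δ (𝟐 :* δ) x a :- Δ δ (𝟐 :* δ) y a := ((:- δ) :* (x :- y)) :* (x :+ y :+ :- (𝟐 :* a))) refl x y a d))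
        (λ {x} {y} solx soly Z≈0 →
           χ≡χd (≈-drop (E≈ solx -[1+ 0 ]
             (solve 4 (λ x y a δ → Δ δ (𝟐 :* δ) x a :+ con -[1+ 0 ] :* W δ a := δ :* (x :* y) :- (δ :* x) :* (x :+ y :+ :- (𝟐 :* a)))
               refl x y a d)) Z≈0) (χ-*≡1ˢ (χx≡τ solx) (χx≡τ soly) ≡.refl)
         , χ≡χd (≈-drop (E≈ solx (+ 2)
             (solve 4 (λ x y a δ → Δ δ (𝟐 :* δ) x a :+ 𝟐 :* W δ a
                                  := δ :* ((x :+ a) :* (y :+ a)) :- (δ :* (x :+ a)) :* (x :+ y :+ :- (𝟐 :* a)))
               refl x y a d)) Z≈0) (χ-*≡1ˢ (χ[x+a]≡σ solx) (χ[x+a]≡σ soly) ≡.refl))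

      count≤bound : ∀ k → count k solutions ≤ bound k π
      count≤bound (0ˢ , 0ˢ) = count₀₀
      count≤bound (0ˢ , 1ˢ) = count₀₊
      count≤bound (0ˢ , -1ˢ) = count₀₋
      count≤bound (1ˢ , 0ˢ) = count₊₀
      count≤bound (1ˢ , 1ˢ) = count₊₊
      count≤bound (1ˢ , -1ˢ) = count₊₋
      count≤bound (-1ˢ , 0ˢ) = count₋₀
      count≤bound (-1ˢ , 1ˢ) = count₋₊
      count≤bound (-1ˢ , -1ˢ) = count₋₋

      E-distinct : ∀ i j → ι (j ℤ.- i) ≉ 0# → E i ≉ E j
      E-distinct i j j-i≉0 Ei≈Ej = j-i≉0 (begin
        ι (j ℤ.- i)    ≈⟨ ι-+ j (ℤ.- i) ⟩
        ι j + ι (ℤ.- i) ≈⟨ +-congˡ (ι-‿ i) ⟩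
        ι j - ι i      ≈⟨ x≈y⇒x-y≈0 (sym ιi≈ιj) ⟩
        0#             ∎)
        where
        ιi≈ιj : ι i ≈ ι j
        ιi≈ιj = *-cancelˡ (*-≉0 d≉0 (*-≉0 a≉0 a≉0))
          (trans (*-comm w (ι i)) (trans (+-cancelˡ b Ei≈Ej) (*-comm (ι j) w)))

      at-most-one-zero : AtMostOneZero π
      at-most-one-zero = AllPairs.map⁺ (AllPairs.map (λ Ei≉Ej χEi≡0 χEj≡0 → Ei≉Ej (trans (χ≡0ˢ⇒≈0 χEi≡0) (sym (χ≡0ˢ⇒≈0 χEj≡0))))
        distinct-values)
        where
        open import Data.List.Relation.Unary.AllPairs as AllPairs using (AllPairs; []; _∷_)
        import Data.List.Relation.Unary.AllPairs.Properties as AllPairs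
        open import Data.List.Relation.Unary.All using ([]; _∷_)
        1≉0′ : ι (+ 1) ≉ 0#
        1≉0′ 1≈0 = 1≉0 (trans (sym (+-identityʳ 1#)) 1≈0)
        distinct-values : AllPairs _≉_ (E -[1+ 1 ] ∷ E -[1+ 0 ] ∷ E (+ 1) ∷ E (+ 2) ∷ [])
        distinct-values =
            (E-distinct -[1+ 1 ] -[1+ 0 ] 1≉0′ ∷ E-distinct -[1+ 1 ] (+ 1) 3≉0 ∷ E-distinct -[1+ 1 ] (+ 2) 4≉0 ∷ [])
          ∷ (E-distinct -[1+ 0 ] (+ 1) 2≉0 ∷ E-distinct -[1+ 0 ] (+ 2) 3≉0 ∷ [])
          ∷ (E-distinct (+ 1) (+ 2) 1≉0′ ∷ []) ∷ [] ∷ []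

      δ≤4 : δ F₂,⅓ a b ≤ 4
      δ≤4 = ℕ.≤-trans (length≤Σcount keys (λ x → ∈-keys (key x)) solutions)
              (ℕ.≤-trans (Σcount≤ {solutions} (λ k → bound k π) count≤bound keys) (total≤4 π (≉0⇒χ≢0ˢ d≉0) at-most-one-zero))

    diffUniformity≤4 : DiffUniformityAtMost F₂,⅓ 4
    diffUniformity≤4 a b a≉0 = Solutions.δ≤4 a≉0 b

module Arithmetic where
  open import Data.Nat using (ℕ; zero; suc; _+_; _*_; _^_; _%_; _/_)
  open import Data.Nat.Divisibility using (_∣_; ∣1⇒≡1)
  open import Data.Nat.DivMod using (m≡m%n+[m/n]*n; [m+kn]%n≡m%n)
  open import Data.Nat.Primality using (Prime; euclidsLemma; ¬prime[1])
  open import Data.Nat.Tactic.RingSolver using (solve-∀)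
  open import Data.Empty using (⊥-elim)
  open import Data.Sum using (inj₁; inj₂)
  open import Relation.Binary.PropositionalEquality using (_≡_; subst; cong; trans; module ≡-Reasoning)

  prime∣m^n⇒prime∣m : ∀ {r} → Prime r → ∀ m n → r ∣ m ^ n → r ∣ m
  prime∣m^n⇒prime∣m r-prime m zero r∣1 = ⊥-elim (¬prime[1] (subst Prime (∣1⇒≡1 r∣1) r-prime))
  prime∣m^n⇒prime∣m r-prime m (suc n) r∣m*m^n with euclidsLemma m (m ^ n) r-prime r∣m*m^n
  ... | inj₁ r∣m = r∣m
  ... | inj₂ r∣m^n = prime∣m^n⇒prime∣m r-prime m n r∣m^n

  %4≡3⇒%2≡1 : ∀ q → q % 4 ≡ 3 → q % 2 ≡ 1
  %4≡3⇒%2≡1 q q%4≡3 = begin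
    q % 2                          ≡⟨ cong (_% 2) (trans (m≡m%n+[m/n]*n q 4) (cong (_+ q / 4 * 4) q%4≡3)) ⟩
    (3 + q / 4 * 4) % 2            ≡⟨ cong (_% 2) (3+4k≡1+2[1+2k] (q / 4)) ⟩
    (1 + (1 + q / 4 * 2) * 2) % 2  ≡⟨ [m+kn]%n≡m%n 1 (1 + q / 4 * 2) 2 ⟩
    1                              ∎
    where
    open ≡-Reasoning
    3+4k≡1+2[1+2k] : ∀ k → 3 + k * 4 ≡ 1 + (1 + k * 2) * 2
    3+4k≡1+2[1+2k] = solve-∀

open import Data.Nat.Divisibility using (_∣_; n∣m⇒m%n≡0)
open import Data.Nat.Primality using (prime?; prime⇒irreducible)
open import Data.Sum using (inj₁; inj₂)
open import Relation.Nullary using (¬_)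
open import Relation.Nullary.Decidable using (toWitness)
open import Relation.Binary.PropositionalEquality using (sym; trans; subst)

corollary2 : ∀ {c ℓ} (𝔽 : FiniteField c ℓ) (p n : ℕ) → Prime p → p ≢ 2 → p ≢ 3 → n ≥ 1
    → FiniteField.order 𝔽 ≡ p ^ n → FiniteField.order 𝔽 % 4 ≡ 3
    → FiniteField.DiffUniformityAtMost 𝔽 (FiniteField.F₂,⅓ 𝔽) 4
corollary2 𝔽 p n p-prime _ p≢3 _ q≡p^n q%4≡3 = diffUniformity≤4 1+1≉0 three≉0 (χ-1≡-1ˢ 1+1≉0 q%4≢1)
  where
  open FiniteField 𝔽 using (order; 0#; 1#; _+_; _≈_; three)
  open FieldProperties 𝔽 using (1+1≈0⇒2∣order; three≈0⇒3∣order)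
  open QuadraticCharacter 𝔽 using (χ-1≡-1ˢ)
  open DifferentialUniformity 𝔽 using (diffUniformity≤4)
  open Arithmetic

  q%4≢1 : order % 4 ≢ 1
  q%4≢1 q%4≡1 with trans (sym q%4≡3) q%4≡1
  ... | ()

  1+1≉0 : ¬ (1# + 1# ≈ 0#)
  1+1≉0 2≈0 with trans (sym (n∣m⇒m%n≡0 order 2 (1+1≈0⇒2∣order 2≈0))) (%4≡3⇒%2≡1 order q%4≡3)
  ... | ()

  three≉0 : ¬ (three ≈ 0#)
  three≉0 3≈0 with prime⇒irreducible p-prime (prime∣m^n⇒prime∣m (toWitness {a? = prime? 3} _) p n
                     (subst (3 ∣_) q≡p^n (three≈0⇒3∣order 3≈0)))
  ... | inj₁ ()
  ... | inj₂ 3≡p = p≢3 (sym 3≡p)
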